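{- Let $U$ be an $n$-dimensional $\mathbb{F}_q$-subspace of $\mathbb{F}_{q^n}^2$ with $\langle U\rangle_{\mathbb{F}_{q^n}}=\mathbb{F}_{q^n}^2$, and let $i$ be a positive integer. If $L_U$ is an $i$-club, then every code associated with $U$ has the following weight distribution: $q^n-1$ codewords of rank weight $n-i$; $(q^n-1)(q^{n-1}+\cdots+q^i)$ codewords of weight $n-1$; $(q^n-1)(q^n-q^{n-1}-\cdots-q^i)$ codewords of weight $n$. Conversely, if $\mathcal{C}$ is a linear non-degenerate $[n,2,n-i]_{q^n/q}$ rank metric code with exactly $q^n-1$ codewords of weight $n-i$ and all remaining nonzero codewords of weight $n-1$ or $n$, then for any system $U$ associated with $\mathcal{C}$, $L_U$ is an $i$-club.
   Context: $q$ is a prime power. The rank weight of $v=(v_1,\ldots,v_n)\in\mathbb{F}_{q^n}^n$ is $\dim_{\mathbb{F}_q}\langle v_1,\ldots,v_n\rangle_{\mathbb{F}_q}$. An $[n,k,d]_{q^n/q}$ code is a $k$-dimensional $\mathbb{F}_{q^n}$-subspace $\mathcal{C}$ of $\mathbb{F}_{q^n}^n$ with minimum rank weight $d$ among nonzero codewords; it is non-degenerate if the columns of a (any) generator matrix are $\mathbb{F}_q$-linearly independent. A code $\mathcal{C}$ with generator matrix $G\in\mathbb{F}_{q^n}^{k\times n}$ and the $\mathbb{F}_q$-span $U\subseteq\mathbb{F}_{q^n}^k$ of the columns of $G$ are said to be associated (code associated with $U$, system associated with $\mathcal{C}$). For an $\mathbb{F}_q$-subspace $U$ of $\mathbb{F}_{q^n}^2$,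 $L_U=\{\langle u\rangle_{\mathbb{F}_{q^n}}:u\in U\setminus\{0\}\}\subseteq\mathrm{PG}(1,q^n)$, the weight of $P=\langle v\rangle_{\mathbb{F}_{q^n}}$ is $\dim_{\mathbb{F}_q}(U\cap\langle v\rangle_{\mathbb{F}_{q^n}})$, and $L_U$ (of rank $n$) is an $i$-club if exactly one of its points has weight $i$ and all its other points have weight $1$. -}

module Defs where

open import Level using (0ℓ)
open import Data.Nat as ℕ using (ℕ; _∸_; _^_)
open import Data.Fin using (Fin)
open import Data.Vec as V using (Vec; []; _∷_; zipWith; replicate; lookup)
open import Data.List as L using (List; length; upTo)
open import Data.List.Relation.Unary.Unique.Propositional using (Unique)
open import Data.List.Membership.Propositional using (_∈_)
open import Data.Product using (Σ; ∃; _×_; _,_)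
open import Data.Sum using (_⊎_)
open import Relation.Nullary using (¬_)
open import Relation.Binary.PropositionalEquality using (_≡_)
open import Relation.Binary.Definitions using (DecidableEquality)
open import Algebra.Structures using (IsCommutativeRing)
open import Function.Bundles using (_⇔_)
open import Data.Nat.ListAction using (sum)

record FiniteField : Set₁ where
  field
    Carrier : Set
    _+_ _*_ : Carrier → Carrier → Carrier
    -_      : Carrier → Carrier
    0# 1#   : Carrier
    isCommutativeRing : IsCommutativeRing _≡_ _+_ _*_ -_ 0# 1#
    0≢1     : ¬ (0# ≡ 1#)
    inverse : ∀ x → ¬ (x ≡ 0#) → ∃ λ y → x * y ≡ 1#
    _≟_     : DecidableEquality Carrier
    elements : List Carrier
    elements-complete : ∀ x → x ∈ elements
    elements-unique   : Unique elements

card : FiniteField → ℕ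
card F = length (FiniteField.elements F)

record Extension (F K : FiniteField) : Set where
  private
    module F = FiniteField F
    module K = FiniteField K
  field
    ι     : F.Carrier → K.Carrier
    ι-+   : ∀ a b → ι (a F.+ b) ≡ ι a K.+ ι b
    ι-*   : ∀ a b → ι (a F.* b) ≡ ι a K.* ι b
    ι-1   : ι F.1# ≡ K.1#

module LinAlg {F K : FiniteField} (E : Extension F K) where
  private
    module F = FiniteField F
    module K = FiniteField K
  open Extension E

  0v : ∀ {m} → Vec K.Carrier m
  0v = replicate _ K.0#

  _⊕_ : ∀ {m} → Vec K.Carrier m → Vec K.Carrier m → Vec K.Carrier m
  _⊕_ = zipWith K._+_

  _⊙_ : ∀ {m} → K.Carrier → Vec K.Carrier m → Vec K.Carrier m
  a ⊙ v = V.map (a K.*_) v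

  Klincomb : ∀ {m d} → Vec K.Carrier d → Vec (Vec K.Carrier m) d → Vec K.Carrier m
  Klincomb []       []       = 0v
  Klincomb (a ∷ as) (v ∷ vs) = (a ⊙ v) ⊕ Klincomb as vs

  Flincomb : ∀ {m d} → Vec F.Carrier d → Vec (Vec K.Carrier m) d → Vec K.Carrier m
  Flincomb cs vs = Klincomb (V.map ι cs) vs

  InFSpan : ∀ {m d} → Vec K.Carrier m → Vec (Vec K.Carrier m) d → Set
  InFSpan w vs = ∃ λ cs → Flincomb cs vs ≡ w

  FIndependent : ∀ {m d} → Vec (Vec K.Carrier m) d → Set
  FIndependent {d = d} vs = ∀ cs → Flincomb cs vs ≡ 0v → cs ≡ replicate d F.0#

  HasFDim : ∀ {m} → (Vec K.Carrier m → Set) → ℕ → Set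
  HasFDim {m} S d = Σ (Vec (Vec K.Carrier m) d) λ b →
    FIndependent b × (∀ w → (S w ⇔ InFSpan w b))

  FSpan : ∀ {m d} → Vec (Vec K.Carrier m) d → Vec K.Carrier m → Set
  FSpan vs w = InFSpan w vs

  KSpansAll : ∀ {m} → (Vec K.Carrier m → Set) → Set
  KSpansAll {m} S = ∀ (v : Vec K.Carrier m) →
    ∃ λ d → Σ (Vec (Vec K.Carrier m) d) λ us →
      (∀ j → S (lookup us j)) × ∃ λ as → Klincomb as us ≡ v

  coords : ∀ {n} → Vec K.Carrier n → Vec (Vec K.Carrier 1) n
  coords = V.map (λ x → x ∷ [])

  RankWeight : ∀ {n} → Vec K.Carrier n → ℕ → Set
  RankWeight v w = HasFDim (FSpan (coords v)) w

  Gen : ℕ → Set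
  Gen n = Vec (Vec K.Carrier n) 2

  InCode : ∀ {n} → Gen n → Vec K.Carrier n → Set
  InCode G c = ∃ λ (x : Vec K.Carrier 2) → Klincomb x G ≡ c

  columns : ∀ {n} → Gen n → Vec (Vec K.Carrier 2) n
  columns G = V.transpose G

  System : ∀ {n} → Gen n → Vec K.Carrier 2 → Set
  System G = FSpan (columns G)

  KRank2 : ∀ {n} → Gen n → Set
  KRank2 G = ∀ x → Klincomb x G ≡ 0v → x ≡ 0v

  NonDegenerate : ∀ {n} → Gen n → Set
  NonDegenerate G = FIndependent (columns G)

  CountIs : ∀ {n} → (Vec K.Carrier n → Set) → ℕ → Set
  CountIs {n} P N = Σ (List (Vec K.Carrier n)) λ l →
    Unique l × length l ≡ N × (∀ c → (c ∈ l ⇔ P c))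

  OnPoint : Vec K.Carrier 2 → Vec K.Carrier 2 → Set
  OnPoint v u = ∃ λ a → u ≡ a ⊙ v

  PointWeight : (Vec K.Carrier 2 → Set) → Vec K.Carrier 2 → ℕ → Set
  PointWeight U v w = HasFDim (λ u → U u × OnPoint v u) w

  -- L_U is an i-club: exactly one point of weight i; every other point
  -- of L_U (i.e. point of positive weight) has weight 1.
  IsClub : (Vec K.Carrier 2 → Set) → ℕ → Set
  IsClub U i = ∃ λ v → ¬ (v ≡ 0v) × PointWeight U v i ×
    (∀ v' → ¬ (v' ≡ 0v) → ¬ OnPoint v v' →
        PointWeight U v' 0 ⊎ PointWeight U v' 1) ×
    (∀ v' → ¬ (v' ≡ 0v) → PointWeight U v' i → OnPoint v v')

geomSum : ℕ → ℕ → ℕ → ℕ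
geomSum q i n = sum (L.map (λ j → q ^ (i ℕ.+ j)) (upTo (n ∸ i)))

-- Write ⟨x, u⟩ = x₀u₀ + x₁u₁ on K². The coordinates of the codeword xG are the values ⟨x, u⟩
-- at the columns u of G, so u ↦ ⟨x, u⟩ maps U F-linearly onto the F-span of those coordinates,
-- with kernel U ∩ ⟨x⊥⟩. Hence  rank weight of xG + weight of the point ⟨x⊥⟩ = n,  and the
-- codewords of weight n − w correspond to the nonzero x whose point ⟨x⊥⟩ has weight w, each point
-- arising from |K| − 1 = q^n − 1 vectors x.
-- If L_U is an i-club, let N₁, N₀ count the nonzero x with ⟨x⊥⟩ of weight 1, 0. Counting K² ∖ {0}
-- gives (q^n − 1) + N₁ + N₀ = q^{2n} − 1, and double counting the pairs (x, u ∈ U ∖ {0}) with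
-- ⟨x, u⟩ = 0 gives (q^n − 1)(q^i − 1) + N₁(q − 1) = (q^n − 1)²; solving yields the distribution.
-- Conversely, the q^n − 1 codewords of weight n − i come from a single point of weight i (a second
-- one would double their number), and the weights n − 1 and n of the other codewords give points
-- of weight 1 and 0.

module Submission where

open import Defs
open import Level using (0ℓ)
open import Algebra.Bundles using (CommutativeRing)
import Algebra.Properties.Ring as RingProperties
import Algebra.Properties.CommutativeSemigroup as CommutativeSemigroupProperties
open import Data.Empty using (⊥; ⊥-elim)
open import Data.Fin using (zero; suc)
open import Data.List as L using (List; []; _∷_; length; _++_; filter; cartesianProductWith; upTo)
open import Data.List.Membership.Propositional using (_∈_; _─_)
open import Data.List.Membership.Propositional.Properties
  using (∈-map⁺; ∈-map⁻; ∈-++⁺ˡ; ∈-++⁺ʳ; ∈-++⁻; ∈-filter⁺; ∈-filter⁻; ∈-cartesianProductWith⁺)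
open import Data.List.Properties using (length-map; length-++; length-removeAt′; map-++; map-cong; upTo-∷ʳ)
open import Data.List.Relation.Binary.Subset.Propositional using () renaming (_⊆_ to _⊆ˡ_)
open import Data.List.Relation.Unary.All as All using (All; []; _∷_)
open import Data.List.Relation.Unary.AllPairs using ([]; _∷_)
open import Data.List.Relation.Unary.Any as Any using (here; there; any?)
open import Data.List.Relation.Unary.Unique.Propositional using (Unique)
import Data.List.Relation.Unary.Unique.Propositional.Properties as Unique
-- The arithmetic operators of ℕ are opened locally, as FieldProperties exports ring operators
-- of the same names.
open import Data.Nat using (ℕ; zero; suc; _≤_; _<_; z≤n; s≤s; >-nonZero)
import Data.Nat.Properties as ℕ
open import Data.Nat.ListAction using (sum)
open import Data.Nat.ListAction.Properties using (sum-++)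
open import Data.Nat.Tactic.RingSolver using (solve-∀)
open import Data.Product using (Σ; ∃; _×_; _,_; proj₁; proj₂)
open import Data.Sum using (_⊎_; inj₁; inj₂; [_,_])
open import Data.Unit using (⊤; tt)
open import Data.Vec as V using (Vec; []; _∷_; zipWith; replicate; lookup)
import Data.Vec.Properties as V
open import Function using (id; _∘_; _∘′_)
open import Function.Bundles using (_⇔_; mk⇔; module Equivalence)
open import Relation.Binary.PropositionalEquality hiding ([_])
import Relation.Binary.PropositionalEquality as ≡
open import Relation.Binary.Definitions using (tri<; tri≈; tri>)
open import Relation.Nullary using (¬_; Dec; yes; no; ¬?)
open import Relation.Nullary.Decidable using (_×-dec_)
open import Relation.Unary using (Pred; _⊆_; Decidable)

open Equivalence using (to; from)

-- Counting finite sets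

Enumeration : Set → Set
Enumeration A = Σ (List A) λ l → Unique l × (∀ x → x ∈ l)

module _ {A : Set} where

  open import Data.Nat using (_+_; _*_; _∸_)

  -- CountIs of Defs, for an arbitrary carrier.
  Count : Pred A 0ℓ → ℕ → Set
  Count P N = Σ (List A) λ l → Unique l × length l ≡ N × (∀ x → (x ∈ l ⇔ P x))

  ∈-─⁺ : ∀ {x y} {xs : List A} (p : x ∈ xs) → y ∈ xs → y ≢ x → y ∈ xs ─ p
  ∈-─⁺ (here refl) (here refl) y≢x = ⊥-elim (y≢x refl)
  ∈-─⁺ (here refl) (there q)   _   = q
  ∈-─⁺ (there p)   (here refl) _   = here refl
  ∈-─⁺ (there p)   (there q)   y≢x = there (∈-─⁺ p q y≢x)

  unique-⊆⇒length≤ : ∀ {xs ys : List A} → Unique xs → xs ⊆ˡ ys → length xs ≤ length ys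
  unique-⊆⇒length≤ {[]}     _          _   = z≤n
  unique-⊆⇒length≤ {x ∷ xs} {ys} (x∉xs ∷ u) xs⊆ys =
    subst (suc (length xs) ≤_) (sym (length-removeAt′ ys _))
      (s≤s (unique-⊆⇒length≤ u λ y∈xs →
        ∈-─⁺ x∈ys (xs⊆ys (there y∈xs)) λ y≡x → All.lookup x∉xs y∈xs (sym y≡x)))
    where x∈ys = xs⊆ys (here refl)

  count-mono : ∀ {P Q : Pred A 0ℓ} {a b} → P ⊆ Q → Count P a → Count Q b → a ≤ b
  count-mono P⊆Q (l₁ , u₁ , refl , m₁) (l₂ , _ , refl , m₂) =
    unique-⊆⇒length≤ u₁ λ x∈l₁ → from (m₂ _) (P⊆Q (to (m₁ _) x∈l₁))

  count-unique : ∀ {P : Pred A 0ℓ} {a b} → Count P a → Count P b → a ≡ b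
  count-unique c₁ c₂ = ℕ.≤-antisym (count-mono id c₁ c₂) (count-mono id c₂ c₁)

  count-cong : ∀ {P Q : Pred A 0ℓ} {a} → (∀ x → P x ⇔ Q x) → Count P a → Count Q a
  count-cong P⇔Q (l , u , len , m) =
    l , u , len , λ x → mk⇔ (to (P⇔Q x) ∘′ to (m x)) (from (m x) ∘′ from (P⇔Q x))

  count-empty : ∀ {P : Pred A 0ℓ} → (∀ x → ¬ P x) → Count P 0
  count-empty ¬P = [] , [] , refl , λ x → mk⇔ (λ ()) (⊥-elim ∘ ¬P x)

  count-singleton : (a : A) → Count (_≡ a) 1
  count-singleton a = a ∷ [] , [] ∷ [] , refl , λ x → mk⇔ (λ { (here e) → e ; (there ()) }) here

  count-⊎ : ∀ {P Q : Pred A 0ℓ} {a b} → (∀ x → P x → ¬ Q x) →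
    Count P a → Count Q b → Count (λ x → P x ⊎ Q x) (a + b)
  count-⊎ {P} {Q} P∩Q=∅ (l₁ , u₁ , refl , m₁) (l₂ , u₂ , refl , m₂) =
    l₁ ++ l₂ ,
    Unique.++⁺ u₁ u₂ (λ { (x∈l₁ , x∈l₂) → P∩Q=∅ _ (to (m₁ _) x∈l₁) (to (m₂ _) x∈l₂) }) ,
    length-++ l₁ ,
    λ x → mk⇔ (into x) (out x)
    where
    into : ∀ x → x ∈ l₁ ++ l₂ → P x ⊎ Q x
    into x x∈ with ∈-++⁻ l₁ x∈
    ... | inj₁ x∈l₁ = inj₁ (to (m₁ x) x∈l₁)
    ... | inj₂ x∈l₂ = inj₂ (to (m₂ x) x∈l₂)
    out : ∀ x → P x ⊎ Q x → x ∈ l₁ ++ l₂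
    out x (inj₁ p) = ∈-++⁺ˡ (from (m₁ x) p)
    out x (inj₂ q) = ∈-++⁺ʳ l₁ (from (m₂ x) q)

  count-all : (E : Enumeration A) → Count (λ _ → ⊤) (length (proj₁ E))
  count-all (l , u , complete) = l , u , refl , λ x → mk⇔ _ (λ _ → complete x)

  count-∩ : ∀ {P Q : Pred A 0ℓ} {N} (Q? : Decidable Q) (c : Count P N) →
    Count (λ x → P x × Q x) (length (filter Q? (proj₁ c)))
  count-∩ Q? (l , u , _ , m) =
    filter Q? l , Unique.filter⁺ Q? u , refl ,
    λ x → mk⇔ (λ x∈ → let x∈l , Qx = ∈-filter⁻ Q? x∈ in to (m x) x∈l , Qx)
              (λ (Px , Qx) → ∈-filter⁺ Q? (from (m x) Px) Qx)

  count-filter : ∀ {P : Pred A 0ℓ} (E : Enumeration A) (P? : Decidable P) →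
    Count P (length (filter P? (proj₁ E)))
  count-filter E P? = count-cong (λ _ → mk⇔ proj₂ (tt ,_)) (count-∩ P? (count-all E))

  count-nonempty : ∀ {P : Pred A 0ℓ} {N} → Count P N → 1 ≤ N → ∃ P
  count-nonempty (x ∷ _ , _ , _ , m) _ = x , to (m x) (here refl)
  count-nonempty ([] , _ , refl , _) ()

  ∃? : ∀ {P : Pred A 0ℓ} → Enumeration A → Decidable P → Dec (∃ P)
  ∃? (l , _ , complete) P? with any? P? l
  ... | yes p = yes (Any.satisfied p)
  ... | no ¬p = no λ (x , Px) → ¬p (Any.map (λ { refl → Px }) (complete x))

  count-remove : ∀ {P : Pred A 0ℓ} {N} (a : A) → (∀ x → Dec (x ≡ a)) → P a → Count P N →
    Count (λ x → P x × x ≢ a) (N ∸ 1)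
  count-remove {P} a _≟a Pa c = subst (Count _) length≡ others
    where
    others = count-∩ (¬? ∘ _≟a) c
    split : ∀ x → (x ≡ a ⊎ P x × x ≢ a) ⇔ P x
    split x = mk⇔ (λ { (inj₁ refl) → Pa ; (inj₂ (Px , _)) → Px }) λ Px → case x Px
      where
      case : ∀ x → P x → x ≡ a ⊎ P x × x ≢ a
      case x Px with x ≟a
      ... | yes x≡a = inj₁ x≡a
      ... | no x≢a  = inj₂ (Px , x≢a)
    length≡ = sym (cong (_∸ 1) (count-unique c
      (count-cong split (count-⊎ (λ { _ refl (_ , a≢a) → a≢a refl }) (count-singleton a) others))))

  ⊆∧count≡⇒⊇ : ∀ {P Q : Pred A 0ℓ} {a} → Decidable P → P ⊆ Q → Count P a → Count Q a → Q ⊆ P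
  ⊆∧count≡⇒⊇ {P} {Q} {a} P? P⊆Q cP cQ {x} Qx with P? x
  ... | yes Px = Px
  ... | no ¬Px = ⊥-elim (ℕ.<-irrefl refl (ℕ.≤-trans (ℕ.≤-reflexive (ℕ.+-comm 1 a))
          (count-mono [ P⊆Q , (λ { refl → Qx }) ]
            (count-⊎ (λ { _ Px refl → ¬Px Px }) cP (count-singleton x)) cQ)))

module _ {A B : Set} where

  open import Data.Nat using (_+_; _*_; _∸_)

  count-map : ∀ {P : Pred A 0ℓ} {Q : Pred B 0ℓ} {N} (f : A → B) →
    (∀ {x y} → P x → P y → f x ≡ f y → x ≡ y) →
    (∀ y → Q y ⇔ ∃ λ x → P x × f x ≡ y) →
    Count P N → Count Q N
  count-map {P} {Q} f f-inj image (l , u , len , m) =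
    L.map f l , map-unique l (All.tabulate λ {x} → to (m x)) u ,
    trans (length-map f l) len , λ y → mk⇔ (into y) (out y)
    where
    map-unique : ∀ xs → All P xs → Unique xs → Unique (L.map f xs)
    map-unique []       _          _          = []
    map-unique (x ∷ xs) (Px ∷ Pxs) (x∉ ∷ u) = distinct xs Pxs x∉ ∷ map-unique xs Pxs u
      where
      distinct : ∀ ys → All P ys → All (x ≢_) ys → All (f x ≢_) (L.map f ys)
      distinct []       _          _          = []
      distinct (y ∷ ys) (Py ∷ Pys) (x≢y ∷ ns) = (x≢y ∘ f-inj Px Py) ∷ distinct ys Pys ns
    into : ∀ y → y ∈ L.map f l → Q y
    into y y∈ with ∈-map⁻ f y∈
    ... | x , x∈l , refl = from (image (f x)) (x , to (m x) x∈l , refl)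
    out : ∀ y → Q y → y ∈ L.map f l
    out y Qy with to (image y) Qy
    ... | x , Px , refl = ∈-map⁺ f (from (m x) Px)

  count-by-fibres : ∀ {P : Pred A 0ℓ} (E : Enumeration B) (f : A → B) (size : B → ℕ) →
    (∀ y → Count (λ x → P x × f x ≡ y) (size y)) → Count P (sum (L.map size (proj₁ E)))
  count-by-fibres {P} (ys , u , complete) f size fibre =
    count-cong (λ x → mk⇔ proj₁ (λ Px → Px , complete (f x))) (over ys u)
    where
    over : ∀ ys → Unique ys → Count (λ x → P x × f x ∈ ys) (sum (L.map size ys))
    over []       _          = count-empty λ { _ (_ , ()) }
    over (y ∷ ys) (y∉ ∷ u) = count-cong
      (λ x → mk⇔ (λ { (inj₁ (Px , refl)) → Px , here refl ; (inj₂ (Px , fx∈)) → Px , there fx∈ })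
                 (λ { (Px , here refl) → inj₁ (Px , refl) ; (Px , there fx∈) → inj₂ (Px , fx∈) }))
      (count-⊎ (λ { _ (_ , refl) (_ , fx∈) → All.lookup y∉ fx∈ refl }) (fibre y) (over ys u))

module _ where

  open import Data.Nat using (_+_; _*_; _^_; _∸_)

  length-cartesianProductWith : ∀ {A B C : Set} (f : A → B → C) (xs : List A) (ys : List B) →
    length (cartesianProductWith f xs ys) ≡ length xs * length ys
  length-cartesianProductWith f []       ys = refl
  length-cartesianProductWith f (x ∷ xs) ys = trans (length-++ (L.map (f x) ys))
    (cong₂ _+_ (length-map (f x) ys) (length-cartesianProductWith f xs ys))

  enumerateVec : ∀ {A : Set} → Enumeration A → (d : ℕ) → Enumeration (Vec A d)
  enumerateVec _ zero = [] ∷ [] , [] ∷ [] , λ { [] → here refl }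
  enumerateVec E@(as , u , complete) (suc d) =
    let vs , u′ , complete′ = enumerateVec E d in
    cartesianProductWith _∷_ as vs ,
    Unique.cartesianProductWith⁺ _∷_ (λ { refl → refl , refl }) u u′ ,
    λ { (a ∷ v) → ∈-cartesianProductWith⁺ _∷_ (complete a) (complete′ v) }

  length-enumerateVec : ∀ {A : Set} (E : Enumeration A) d →
    length (proj₁ (enumerateVec E d)) ≡ length (proj₁ E) ^ d
  length-enumerateVec E zero    = refl
  length-enumerateVec E (suc d) = trans (length-cartesianProductWith _∷_ (proj₁ E) _)
    (cong (length (proj₁ E) *_) (length-enumerateVec E d))

  indicator : ∀ {X : Set} → Dec X → ℕ → ℕ
  indicator (yes _) c = c
  indicator (no _)  _ = 0

  module _ {A : Set} where

    open import Data.Nat using (_+_; _*_; _∸_)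

    sum-map-+ : ∀ (f g : A → ℕ) xs →
      sum (L.map (λ x → f x + g x) xs) ≡ sum (L.map f xs) + sum (L.map g xs)
    sum-map-+ f g []       = refl
    sum-map-+ f g (x ∷ xs) rewrite sum-map-+ f g xs =
      +-interchange (f x) (g x) (sum (L.map f xs)) (sum (L.map g xs))
      where
      +-interchange : ∀ a b c d → a + b + (c + d) ≡ a + c + (b + d)
      +-interchange = solve-∀

    sum-indicator : ∀ {P : Pred A 0ℓ} (P? : Decidable P) c xs →
      sum (L.map (λ x → indicator (P? x) c) xs) ≡ length (filter P? xs) * c
    sum-indicator P? c []       = refl
    sum-indicator P? c (x ∷ xs) with P? x
    ... | yes _ = cong (c +_) (sum-indicator P? c xs)
    ... | no _  = sum-indicator P? c xs

  ^-injective : ∀ {q a b} → 2 ≤ q → q ^ a ≡ q ^ b → a ≡ b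
  ^-injective {q} {a} {b} 2≤q qᵃ≡qᵇ with ℕ.<-cmp a b
  ... | tri< a<b _ _ = ⊥-elim (ℕ.<-irrefl qᵃ≡qᵇ (ℕ.^-monoʳ-< q 2≤q a<b))
  ... | tri≈ _ a≡b _ = a≡b
  ... | tri> _ _ b<a = ⊥-elim (ℕ.<-irrefl (sym qᵃ≡qᵇ) (ℕ.^-monoʳ-< q 2≤q b<a))

  ^-cancelˡ-≤ : ∀ {q a b} → 2 ≤ q → q ^ a ≤ q ^ b → a ≤ b
  ^-cancelˡ-≤ {q} {a} {b} 2≤q qᵃ≤qᵇ with ℕ.≤-<-connex a b
  ... | inj₁ a≤b = a≤b
  ... | inj₂ b<a = ⊥-elim (ℕ.<⇒≱ (ℕ.^-monoʳ-< q 2≤q b<a) qᵃ≤qᵇ)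

  geometric-telescope : ∀ r i k →
    suc r ^ i + sum (L.map (λ j → suc r ^ (i + j)) (upTo k)) * r ≡ suc r ^ (i + k)
  geometric-telescope r i zero = trans (ℕ.+-identityʳ _) (cong (suc r ^_) (sym (ℕ.+-identityʳ i)))
  geometric-telescope r i (suc k) = begin
    q ^ i + sum (L.map t (upTo (suc k))) * r
      ≡⟨ cong (λ js → q ^ i + sum (L.map t js) * r) (sym (upTo-∷ʳ k)) ⟩
    q ^ i + sum (L.map t (upTo k L.∷ʳ k)) * r
      ≡⟨ cong (λ s → q ^ i + s * r) (trans (cong sum (map-++ t (upTo k) _)) (sum-++ (L.map t (upTo k)) _)) ⟩
    q ^ i + (S + (q ^ (i + k) + 0)) * r
      ≡⟨ regroup (q ^ i) S (q ^ (i + k)) r ⟩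
    (q ^ i + S * r) + q ^ (i + k) * r
      ≡⟨ cong (_+ q ^ (i + k) * r) (geometric-telescope r i k) ⟩
    q ^ (i + k) + q ^ (i + k) * r
      ≡⟨ cong (q ^ (i + k) +_) (ℕ.*-comm (q ^ (i + k)) r) ⟩
    q ^ suc (i + k)
      ≡⟨ cong (q ^_) (sym (ℕ.+-suc i k)) ⟩
    q ^ (i + suc k) ∎
    where
    open ≡-Reasoning
    q = suc r
    t = λ j → q ^ (i + j)
    S = sum (L.map t (upTo k))
    regroup : ∀ a s b r → a + (s + (b + 0)) * r ≡ (a + s * r) + b * r
    regroup = solve-∀

  geomSum-telescope : ∀ {q} i n → 1 ≤ q → i ≤ n → q ^ i + geomSum q i n * (q ∸ 1) ≡ q ^ n
  geomSum-telescope {suc r} i n _ i≤n =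
    trans (geometric-telescope r i (n ∸ i)) (cong (suc r ^_) (ℕ.m+[n∸m]≡n i≤n))

  count-from-double-count : ∀ {A a g d N} → 1 ≤ d → suc A ≡ suc a + g * d →
    A * a + N * d ≡ A * A → N ≡ A * g
  count-from-double-count {A} {a} {g} {suc r} {N} _ total double-count =
    ℕ.*-cancelʳ-≡ N (A * g) (suc r) (ℕ.+-cancelˡ-≡ (A * a) _ _ (begin
      A * a + N * suc r          ≡⟨ double-count ⟩
      A * A                      ≡⟨ cong (A *_) (ℕ.suc-injective total) ⟩
      A * (a + g * suc r)        ≡⟨ distribute A a g (suc r) ⟩
      A * a + A * g * suc r      ∎))
    where
    open ≡-Reasoning
    distribute : ∀ A a g d → A * (a + g * d) ≡ A * a + A * g * d
    distribute = solve-∀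

  count-from-partition : ∀ {A N₁ N₀ g} → A + N₁ + N₀ ≡ suc A * suc A ∸ 1 → N₁ ≡ A * g →
    N₀ ≡ A * (suc A ∸ g)
  count-from-partition {A} {N₁} {N₀} {g} partition refl = begin
    N₀                          ≡⟨ sym (ℕ.m+n∸m≡n (A * g) N₀) ⟩
    A * g + N₀ ∸ A * g          ≡⟨ cong (_∸ A * g) (ℕ.+-cancelˡ-≡ A _ _ A+[Ag+N₀]≡A+A*sucA) ⟩
    A * suc A ∸ A * g           ≡⟨ sym (ℕ.*-distribˡ-∸ A (suc A) g) ⟩
    A * (suc A ∸ g)             ∎
    where
    open ≡-Reasoning
    A+[Ag+N₀]≡A+A*sucA = trans (sym (ℕ.+-assoc A (A * g) N₀)) partition

module FieldProperties (K : FiniteField) where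

  open FiniteField K public using (_≟_; inverse; 0≢1)

  commutativeRing : CommutativeRing 0ℓ 0ℓ
  commutativeRing = record { isCommutativeRing = FiniteField.isCommutativeRing K }

  open CommutativeRing commutativeRing public hiding (refl; sym; trans)
  open RingProperties ring public
  open CommutativeSemigroupProperties +-commutativeSemigroup public using () renaming (interchange to +-interchange)
  open CommutativeSemigroupProperties *-commutativeSemigroup public using () renaming (x∙yz≈y∙xz to *-lcomm)

  enumeration : Enumeration Carrier
  enumeration = FiniteField.elements K , FiniteField.elements-unique K , FiniteField.elements-complete K

  2≤card : 2 ≤ card K
  2≤card = count-mono _
    (count-⊎ (λ { _ refl 0≡1 → 0≢1 0≡1 }) (count-singleton 0#) (count-singleton 1#))
    (count-all enumeration)

  1≢0 : 1# ≢ 0#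
  1≢0 = 0≢1 ∘ ≡.sym

  x*y≡0⇒y≡0 : ∀ {x y} → x ≢ 0# → x * y ≡ 0# → y ≡ 0#
  x*y≡0⇒y≡0 {x} {y} x≢0 xy≡0 = begin
    y              ≡⟨ ≡.sym (*-identityˡ y) ⟩
    1# * y         ≡⟨ ≡.cong (_* y) (≡.sym x⁻¹x≡1) ⟩
    (x⁻¹ * x) * y  ≡⟨ *-assoc x⁻¹ x y ⟩
    x⁻¹ * (x * y)  ≡⟨ ≡.cong (x⁻¹ *_) xy≡0 ⟩
    x⁻¹ * 0#       ≡⟨ zeroʳ x⁻¹ ⟩
    0#             ∎
    where
    open ≡-Reasoning
    x⁻¹ = proj₁ (inverse x x≢0)
    x⁻¹x≡1 = ≡.trans (*-comm x⁻¹ x) (proj₂ (inverse x x≢0))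

  -x*-y≡x*y : ∀ x y → (- x) * (- y) ≡ x * y
  -x*-y≡x*y x y = begin
    (- x) * (- y)   ≡⟨ ≡.sym (-‿distribˡ-* x (- y)) ⟩
    - (x * (- y))   ≡⟨ ≡.cong -_ (≡.sym (-‿distribʳ-* x y)) ⟩
    - (- (x * y))   ≡⟨ -‿involutive (x * y) ⟩
    x * y           ∎
    where open ≡-Reasoning

  zipWith-x-y≡0⇒≡ : ∀ {d} (xs ys : Vec Carrier d) →
    zipWith _+_ xs (V.map -_ ys) ≡ replicate d 0# → xs ≡ ys
  zipWith-x-y≡0⇒≡ []       []       _ = ≡.refl
  zipWith-x-y≡0⇒≡ (x ∷ xs) (y ∷ ys) e =
    ≡.cong₂ _∷_ (x∙y⁻¹≈ε⇒x≈y x y (≡.cong V.head e)) (zipWith-x-y≡0⇒≡ xs ys (≡.cong V.tail e))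

module _ {F K : FiniteField} (E : Extension F K) where

  private
    module F = FieldProperties F
    module K = FieldProperties K

  open LinAlg E
  open Extension E
  open import Data.Nat using (_+_; _*_; _^_; _∸_)

  ι-0 : ι F.0# ≡ K.0#
  ι-0 = K.x+x≈x⇒x≈0 (ι F.0#) (trans (sym (ι-+ F.0# F.0#)) (cong ι (F.+-identityʳ F.0#)))

  ι-neg : ∀ a → ι (F.- a) ≡ K.- ι a
  ι-neg a = K.+-inverseˡ-unique (ι (F.- a)) (ι a)
    (trans (sym (ι-+ (F.- a) a)) (trans (cong ι (F.-‿inverseˡ a)) ι-0))

  ⊖_ : ∀ {m} → Vec K.Carrier m → Vec K.Carrier m
  ⊖ v = V.map K.-_ v

  _≟ᵛ_ : ∀ {m} → (u v : Vec K.Carrier m) → Dec (u ≡ v)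
  _≟ᵛ_ = V.≡-dec K._≟_

  ⊕-comm : ∀ {m} (u v : Vec K.Carrier m) → u ⊕ v ≡ v ⊕ u
  ⊕-comm []      []      = refl
  ⊕-comm (a ∷ u) (b ∷ v) = cong₂ _∷_ (K.+-comm a b) (⊕-comm u v)

  ⊕-assoc : ∀ {m} (u v w : Vec K.Carrier m) → (u ⊕ v) ⊕ w ≡ u ⊕ (v ⊕ w)
  ⊕-assoc []      []      []      = refl
  ⊕-assoc (a ∷ u) (b ∷ v) (c ∷ w) = cong₂ _∷_ (K.+-assoc a b c) (⊕-assoc u v w)

  ⊕-identityˡ : ∀ {m} (u : Vec K.Carrier m) → 0v ⊕ u ≡ u
  ⊕-identityˡ []      = refl
  ⊕-identityˡ (a ∷ u) = cong₂ _∷_ (K.+-identityˡ a) (⊕-identityˡ u)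

  ⊕-identityʳ : ∀ {m} (u : Vec K.Carrier m) → u ⊕ 0v ≡ u
  ⊕-identityʳ u = trans (⊕-comm u 0v) (⊕-identityˡ u)

  ⊕-inverseʳ : ∀ {m} (u : Vec K.Carrier m) → u ⊕ (⊖ u) ≡ 0v
  ⊕-inverseʳ []      = refl
  ⊕-inverseʳ (a ∷ u) = cong₂ _∷_ (K.-‿inverseʳ a) (⊕-inverseʳ u)

  ⊕-interchange : ∀ {m} (a b c d : Vec K.Carrier m) → (a ⊕ b) ⊕ (c ⊕ d) ≡ (a ⊕ c) ⊕ (b ⊕ d)
  ⊕-interchange []       []       []       []       = refl
  ⊕-interchange (a ∷ as) (b ∷ bs) (c ∷ cs) (d ∷ ds) =
    cong₂ _∷_ (K.+-interchange a b c d) (⊕-interchange as bs cs ds)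

  ⊕-cancelˡ : ∀ {m} (u v w : Vec K.Carrier m) → u ⊕ v ≡ u ⊕ w → v ≡ w
  ⊕-cancelˡ []      []      []      _ = refl
  ⊕-cancelˡ (a ∷ u) (b ∷ v) (c ∷ w) e =
    cong₂ _∷_ (K.+-cancelˡ a b c (cong V.head e)) (⊕-cancelˡ u v w (cong V.tail e))

  ⊙-distribˡ-⊕ : ∀ {m} a (u v : Vec K.Carrier m) → a ⊙ (u ⊕ v) ≡ (a ⊙ u) ⊕ (a ⊙ v)
  ⊙-distribˡ-⊕ a []      []      = refl
  ⊙-distribˡ-⊕ a (x ∷ u) (y ∷ v) = cong₂ _∷_ (K.distribˡ a x y) (⊙-distribˡ-⊕ a u v)

  ⊙-distribʳ-+ : ∀ {m} a b (u : Vec K.Carrier m) → (a K.+ b) ⊙ u ≡ (a ⊙ u) ⊕ (b ⊙ u)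
  ⊙-distribʳ-+ a b []      = refl
  ⊙-distribʳ-+ a b (x ∷ u) = cong₂ _∷_ (K.distribʳ x a b) (⊙-distribʳ-+ a b u)

  ⊙-assoc : ∀ {m} a b (u : Vec K.Carrier m) → (a K.* b) ⊙ u ≡ a ⊙ (b ⊙ u)
  ⊙-assoc a b []      = refl
  ⊙-assoc a b (x ∷ u) = cong₂ _∷_ (K.*-assoc a b x) (⊙-assoc a b u)

  ⊙-identityˡ : ∀ {m} (u : Vec K.Carrier m) → K.1# ⊙ u ≡ u
  ⊙-identityˡ []      = refl
  ⊙-identityˡ (x ∷ u) = cong₂ _∷_ (K.*-identityˡ x) (⊙-identityˡ u)

  ⊙-zeroˡ : ∀ {m} (u : Vec K.Carrier m) → K.0# ⊙ u ≡ 0v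
  ⊙-zeroˡ []      = refl
  ⊙-zeroˡ (x ∷ u) = cong₂ _∷_ (K.zeroˡ x) (⊙-zeroˡ u)

  ⊙-zeroʳ : ∀ {m} a → a ⊙ 0v {m} ≡ 0v
  ⊙-zeroʳ {zero}  a = refl
  ⊙-zeroʳ {suc m} a = cong₂ _∷_ (K.zeroʳ a) (⊙-zeroʳ {m} a)

  -‿⊙ : ∀ {m} a (u : Vec K.Carrier m) → (K.- a) ⊙ u ≡ ⊖ (a ⊙ u)
  -‿⊙ a []      = refl
  -‿⊙ a (x ∷ u) = cong₂ _∷_ (sym (K.-‿distribˡ-* a x)) (-‿⊙ a u)

  -1⊙u≡⊖u : ∀ {m} (u : Vec K.Carrier m) → (K.- K.1#) ⊙ u ≡ ⊖ u
  -1⊙u≡⊖u u = trans (-‿⊙ K.1# u) (cong ⊖_ (⊙-identityˡ u))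

  a⊙u≡0⇒a≡0 : ∀ {m} a (u : Vec K.Carrier m) → u ≢ 0v → a ⊙ u ≡ 0v → a ≡ K.0#
  a⊙u≡0⇒a≡0 a []      u≢0 _ = ⊥-elim (u≢0 refl)
  a⊙u≡0⇒a≡0 a (x ∷ u) u≢0 e with x K.≟ K.0#
  ... | yes refl = a⊙u≡0⇒a≡0 a u (u≢0 ∘ cong (K.0# ∷_)) (cong V.tail e)
  ... | no x≢0   = K.x*y≡0⇒y≡0 x≢0 (trans (K.*-comm x a) (cong V.head e))

  ⊙-cancelʳ : ∀ {m} a b (u : Vec K.Carrier m) → u ≢ 0v → a ⊙ u ≡ b ⊙ u → a ≡ b
  ⊙-cancelʳ a b u u≢0 e = K.x∙y⁻¹≈ε⇒x≈y a b (a⊙u≡0⇒a≡0 (a K.- b) u u≢0 (begin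
    (a K.- b) ⊙ u           ≡⟨ ⊙-distribʳ-+ a (K.- b) u ⟩
    (a ⊙ u) ⊕ ((K.- b) ⊙ u) ≡⟨ cong₂ _⊕_ e (-‿⊙ b u) ⟩
    (b ⊙ u) ⊕ (⊖ (b ⊙ u))   ≡⟨ ⊕-inverseʳ (b ⊙ u) ⟩
    0v                      ∎))
    where open ≡-Reasoning

  Klincomb-+ : ∀ {m d} (as bs : Vec K.Carrier d) (vs : Vec (Vec K.Carrier m) d) →
    Klincomb (zipWith K._+_ as bs) vs ≡ Klincomb as vs ⊕ Klincomb bs vs
  Klincomb-+ []       []       []       = sym (⊕-identityˡ 0v)
  Klincomb-+ (a ∷ as) (b ∷ bs) (v ∷ vs) = begin
    ((a K.+ b) ⊙ v) ⊕ Klincomb (zipWith K._+_ as bs) vs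
      ≡⟨ cong₂ _⊕_ (⊙-distribʳ-+ a b v) (Klincomb-+ as bs vs) ⟩
    ((a ⊙ v) ⊕ (b ⊙ v)) ⊕ (Klincomb as vs ⊕ Klincomb bs vs)
      ≡⟨ ⊕-interchange (a ⊙ v) (b ⊙ v) (Klincomb as vs) (Klincomb bs vs) ⟩
    ((a ⊙ v) ⊕ Klincomb as vs) ⊕ ((b ⊙ v) ⊕ Klincomb bs vs) ∎
    where open ≡-Reasoning

  Klincomb-* : ∀ {m d} c (as : Vec K.Carrier d) (vs : Vec (Vec K.Carrier m) d) →
    Klincomb (V.map (c K.*_) as) vs ≡ c ⊙ Klincomb as vs
  Klincomb-* c []       []       = sym (⊙-zeroʳ c)
  Klincomb-* c (a ∷ as) (v ∷ vs) = trans (cong₂ _⊕_ (⊙-assoc c a v) (Klincomb-* c as vs))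
    (sym (⊙-distribˡ-⊕ c (a ⊙ v) (Klincomb as vs)))

  Klincomb-0 : ∀ {m d} (vs : Vec (Vec K.Carrier m) d) → Klincomb (replicate d K.0#) vs ≡ 0v
  Klincomb-0 []       = refl
  Klincomb-0 (v ∷ vs) = trans (cong₂ _⊕_ (⊙-zeroˡ v) (Klincomb-0 vs)) (⊕-identityˡ 0v)

  Klincomb-neg : ∀ {m d} (as : Vec K.Carrier d) (vs : Vec (Vec K.Carrier m) d) →
    Klincomb (V.map K.-_ as) vs ≡ ⊖ Klincomb as vs
  Klincomb-neg as vs = begin
    Klincomb (V.map K.-_ as) vs
      ≡⟨ cong (λ cs → Klincomb cs vs) (V.map-cong (λ a → sym (K.-1*x≈-x a)) as) ⟩
    Klincomb (V.map ((K.- K.1#) K.*_) as) vs   ≡⟨ Klincomb-* (K.- K.1#) as vs ⟩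
    (K.- K.1#) ⊙ Klincomb as vs                ≡⟨ -1⊙u≡⊖u (Klincomb as vs) ⟩
    ⊖ Klincomb as vs                           ∎
    where open ≡-Reasoning

  Klincomb-injective : ∀ {m d} {vs : Vec (Vec K.Carrier m) d} →
    (∀ as → Klincomb as vs ≡ 0v → as ≡ replicate d K.0#) →
    ∀ as bs → Klincomb as vs ≡ Klincomb bs vs → as ≡ bs
  Klincomb-injective {vs = vs} independent as bs e = K.zipWith-x-y≡0⇒≡ as bs (independent _ (begin
    Klincomb (zipWith K._+_ as (V.map K.-_ bs)) vs   ≡⟨ Klincomb-+ as (V.map K.-_ bs) vs ⟩
    Klincomb as vs ⊕ Klincomb (V.map K.-_ bs) vs     ≡⟨ cong₂ _⊕_ e (Klincomb-neg bs vs) ⟩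
    Klincomb bs vs ⊕ (⊖ Klincomb bs vs)              ≡⟨ ⊕-inverseʳ (Klincomb bs vs) ⟩
    0v                                               ∎))
    where open ≡-Reasoning

  private
    map-ι-+ : ∀ {d} (cs ds : Vec F.Carrier d) →
      V.map ι (zipWith F._+_ cs ds) ≡ zipWith K._+_ (V.map ι cs) (V.map ι ds)
    map-ι-+ []       []       = refl
    map-ι-+ (c ∷ cs) (d ∷ ds) = cong₂ _∷_ (ι-+ c d) (map-ι-+ cs ds)

    map-ι-* : ∀ {d} k (cs : Vec F.Carrier d) → V.map ι (V.map (k F.*_) cs) ≡ V.map (ι k K.*_) (V.map ι cs)
    map-ι-* k []       = refl
    map-ι-* k (c ∷ cs) = cong₂ _∷_ (ι-* k c) (map-ι-* k cs)

    map-ι-0 : ∀ d → V.map ι (replicate d F.0#) ≡ replicate d K.0#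
    map-ι-0 d = trans (V.map-replicate ι F.0# d) (cong (replicate d) ι-0)

  Flincomb-+ : ∀ {m d} (cs ds : Vec F.Carrier d) (vs : Vec (Vec K.Carrier m) d) →
    Flincomb (zipWith F._+_ cs ds) vs ≡ Flincomb cs vs ⊕ Flincomb ds vs
  Flincomb-+ cs ds vs = trans (cong (λ as → Klincomb as vs) (map-ι-+ cs ds)) (Klincomb-+ (V.map ι cs) (V.map ι ds) vs)

  Flincomb-* : ∀ {m d} k (cs : Vec F.Carrier d) (vs : Vec (Vec K.Carrier m) d) →
    Flincomb (V.map (k F.*_) cs) vs ≡ ι k ⊙ Flincomb cs vs
  Flincomb-* k cs vs = trans (cong (λ as → Klincomb as vs) (map-ι-* k cs)) (Klincomb-* (ι k) (V.map ι cs) vs)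

  Flincomb-0 : ∀ {m d} (vs : Vec (Vec K.Carrier m) d) → Flincomb (replicate d F.0#) vs ≡ 0v
  Flincomb-0 {d = d} vs = trans (cong (λ as → Klincomb as vs) (map-ι-0 d)) (Klincomb-0 vs)

  Flincomb-neg : ∀ {m d} (cs : Vec F.Carrier d) (vs : Vec (Vec K.Carrier m) d) →
    Flincomb (V.map F.-_ cs) vs ≡ ⊖ Flincomb cs vs
  Flincomb-neg cs vs = trans (cong (λ as → Klincomb as vs) map-ι-neg) (Klincomb-neg (V.map ι cs) vs)
    where
    map-ι-neg : V.map ι (V.map F.-_ cs) ≡ V.map K.-_ (V.map ι cs)
    map-ι-neg = trans (sym (V.map-∘ ι F.-_ cs))
      (trans (V.map-cong ι-neg cs) (V.map-∘ K.-_ ι cs))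

  Flincomb-injective : ∀ {m d} {b : Vec (Vec K.Carrier m) d} → FIndependent b →
    ∀ cs ds → Flincomb cs b ≡ Flincomb ds b → cs ≡ ds
  Flincomb-injective {b = b} independent cs ds e = F.zipWith-x-y≡0⇒≡ cs ds (independent _ (begin
    Flincomb (zipWith F._+_ cs (V.map F.-_ ds)) b   ≡⟨ Flincomb-+ cs (V.map F.-_ ds) b ⟩
    Flincomb cs b ⊕ Flincomb (V.map F.-_ ds) b      ≡⟨ cong₂ _⊕_ e (Flincomb-neg ds b) ⟩
    Flincomb ds b ⊕ (⊖ Flincomb ds b)               ≡⟨ ⊕-inverseʳ (Flincomb ds b) ⟩
    0v                                              ∎))
    where open ≡-Reasoning

  -- F-subspaces, dimension and rank weight

  record IsFSubspace {m} (S : Vec K.Carrier m → Set) : Set where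
    field
      0∈       : S 0v
      ⊕-closed : ∀ {u w} → S u → S w → S (u ⊕ w)
      ι⊙-closed : ∀ c {u} → S u → S (ι c ⊙ u)

    ⊖-closed : ∀ {u} → S u → S (⊖ u)
    ⊖-closed {u} Su = subst S ι[-1]⊙u≡⊖u (ι⊙-closed (F.- F.1#) Su)
      where
      ι[-1]⊙u≡⊖u : ι (F.- F.1#) ⊙ u ≡ ⊖ u
      ι[-1]⊙u≡⊖u = trans (cong (_⊙ u) (trans (ι-neg F.1#) (cong K.-_ ι-1))) (-1⊙u≡⊖u u)

    Flincomb-closed : ∀ {d} (vs : Vec (Vec K.Carrier m) d) → (∀ j → S (lookup vs j)) →
      ∀ cs → S (Flincomb cs vs)
    Flincomb-closed []       _     []       = 0∈
    Flincomb-closed (v ∷ vs) vs∈S (c ∷ cs) =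
      ⊕-closed (ι⊙-closed c (vs∈S zero)) (Flincomb-closed vs (vs∈S ∘ suc) cs)

  FSpan-isFSubspace : ∀ {m d} (vs : Vec (Vec K.Carrier m) d) → IsFSubspace (FSpan vs)
  FSpan-isFSubspace {d = d} vs = record
    { 0∈        = replicate d F.0# , Flincomb-0 vs
    ; ⊕-closed  = λ { (cs , refl) (ds , refl) → zipWith F._+_ cs ds , Flincomb-+ cs ds vs }
    ; ι⊙-closed = λ { c (cs , refl) → V.map (c F.*_) cs , Flincomb-* c cs vs }
    }

  ∩-isFSubspace : ∀ {m} {S T : Vec K.Carrier m → Set} →
    IsFSubspace S → IsFSubspace T → IsFSubspace (λ w → S w × T w)
  ∩-isFSubspace S-sub T-sub = record
    { 0∈        = S.0∈ , T.0∈
    ; ⊕-closed  = λ (Su , Tu) (Sw , Tw) → S.⊕-closed Su Sw , T.⊕-closed Tu Tw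
    ; ι⊙-closed = λ c (Su , Tu) → S.ι⊙-closed c Su , T.ι⊙-closed c Tu
    }
    where
    module S = IsFSubspace S-sub
    module T = IsFSubspace T-sub

  InFSpan? : ∀ {m d} (w : Vec K.Carrier m) (vs : Vec (Vec K.Carrier m) d) → Dec (InFSpan w vs)
  InFSpan? {d = d} w vs = ∃? (enumerateVec F.enumeration d) (λ cs → Flincomb cs vs ≟ᵛ w)

  InFSpan-∷ : ∀ {m d} {u : Vec K.Carrier m} (w : Vec K.Carrier m) {b : Vec (Vec K.Carrier m) d} →
    InFSpan u b → InFSpan u (w ∷ b)
  InFSpan-∷ w {b} (cs , refl) =
    F.0# ∷ cs , trans (cong (_⊕ Flincomb cs b) (trans (cong (_⊙ w) ι-0) (⊙-zeroˡ w))) (⊕-identityˡ _)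

  InFSpan-head : ∀ {m d} (w : Vec K.Carrier m) (b : Vec (Vec K.Carrier m) d) → InFSpan w (w ∷ b)
  InFSpan-head w b = F.1# ∷ replicate _ F.0# ,
    trans (cong₂ _⊕_ (trans (cong (_⊙ w) ι-1) (⊙-identityˡ w)) (Flincomb-0 b)) (⊕-identityʳ w)

  FIndependent-∷ : ∀ {m d} (w : Vec K.Carrier m) {b : Vec (Vec K.Carrier m) d} →
    FIndependent b → ¬ InFSpan w b → FIndependent (w ∷ b)
  FIndependent-∷ w {b} independent w∉ (c ∷ cs) e with c F.≟ F.0#
  ... | yes refl = cong (F.0# ∷_) (independent cs (begin
    Flincomb cs b                      ≡⟨ sym (⊕-identityˡ _) ⟩
    0v ⊕ Flincomb cs b                 ≡⟨ cong (_⊕ Flincomb cs b) (sym (trans (cong (_⊙ w) ι-0) (⊙-zeroˡ w))) ⟩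
    (ι F.0# ⊙ w) ⊕ Flincomb cs b       ≡⟨ e ⟩
    0v                                 ∎))
    where open ≡-Reasoning
  ... | no c≢0 = ⊥-elim (w∉ (V.map (F.- c⁻¹ F.*_) cs , (begin
    Flincomb (V.map (F.- c⁻¹ F.*_) cs) b   ≡⟨ Flincomb-* (F.- c⁻¹) cs b ⟩
    ι (F.- c⁻¹) ⊙ Flincomb cs b            ≡⟨ cong (ι (F.- c⁻¹) ⊙_) rest≡-cw ⟩
    ι (F.- c⁻¹) ⊙ (ι (F.- c) ⊙ w)          ≡⟨ sym (⊙-assoc (ι (F.- c⁻¹)) (ι (F.- c)) w) ⟩
    (ι (F.- c⁻¹) K.* ι (F.- c)) ⊙ w        ≡⟨ cong (_⊙ w) (trans (sym (ι-* (F.- c⁻¹) (F.- c))) (cong ι c⁻¹c≡1)) ⟩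
    ι F.1# ⊙ w                             ≡⟨ trans (cong (_⊙ w) ι-1) (⊙-identityˡ w) ⟩
    w                                      ∎)))
    where
    open ≡-Reasoning
    c⁻¹ = proj₁ (F.inverse c c≢0)
    c⁻¹c≡1 : (F.- c⁻¹) F.* (F.- c) ≡ F.1#
    c⁻¹c≡1 = begin
      (F.- c⁻¹) F.* (F.- c)   ≡⟨ sym (F.-‿distribˡ-* c⁻¹ (F.- c)) ⟩
      F.- (c⁻¹ F.* (F.- c))   ≡⟨ cong F.-_ (sym (F.-‿distribʳ-* c⁻¹ c)) ⟩
      F.- (F.- (c⁻¹ F.* c))   ≡⟨ F.-‿involutive _ ⟩
      c⁻¹ F.* c               ≡⟨ F.*-comm c⁻¹ c ⟩
      c F.* c⁻¹               ≡⟨ proj₂ (F.inverse c c≢0) ⟩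
      F.1#                    ∎
    rest≡-cw : Flincomb cs b ≡ ι (F.- c) ⊙ w
    rest≡-cw = ⊕-cancelˡ (ι c ⊙ w) _ _ (trans e (sym (begin
      (ι c ⊙ w) ⊕ (ι (F.- c) ⊙ w)   ≡⟨ sym (⊙-distribʳ-+ (ι c) (ι (F.- c)) w) ⟩
      (ι c K.+ ι (F.- c)) ⊙ w       ≡⟨ cong (_⊙ w) (trans (sym (ι-+ c (F.- c))) (trans (cong ι (F.-‿inverseʳ c)) ι-0)) ⟩
      K.0# ⊙ w                      ≡⟨ ⊙-zeroˡ w ⟩
      0v                            ∎)))

  module _ {m} {S : Vec K.Carrier m → Set} (S? : Decidable S) (S-sub : IsFSubspace S) where

    private
      Vm = Vec K.Carrier m

      record IndependentExtension (L : List Vm) {d} (b : Vec Vm d) : Set where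
        field
          {size}      : ℕ
          basis       : Vec Vm size
          independent : FIndependent basis
          basis⊆S     : ∀ j → S (lookup basis j)
          extends     : ∀ w → InFSpan w b → InFSpan w basis
          covers      : ∀ w → w ∈ L → S w → InFSpan w basis

      extend : ∀ L {d} (b : Vec Vm d) → FIndependent b → (∀ j → S (lookup b j)) →
        IndependentExtension L b
      extend [] b independent b⊆S = record
        { basis = b ; independent = independent ; basis⊆S = b⊆S
        ; extends = λ _ w∈ → w∈ ; covers = λ _ () }
      extend (w ∷ L) b independent b⊆S with S? w | InFSpan? w b
      ... | yes Sw | no w∉ = record
        { IndependentExtension rec
        ; extends = λ u u∈ → extends u (InFSpan-∷ w u∈)
        ; covers  = λ { u (here refl) _ → extends u (InFSpan-head w b)
                      ; u (there u∈L) Su → covers u u∈L Su } }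
        where
        rec = extend L (w ∷ b) (FIndependent-∷ w independent w∉) λ { zero → Sw ; (suc j) → b⊆S j }
        open IndependentExtension rec
      ... | yes _ | yes w∈ = record
        { IndependentExtension rec
        ; covers = λ { u (here refl) _ → extends u w∈ ; u (there u∈L) Su → covers u u∈L Su } }
        where
        rec = extend L b independent b⊆S
        open IndependentExtension rec
      ... | no ¬Sw | _ = record
        { IndependentExtension rec
        ; covers = λ { u (here refl) Su → ⊥-elim (¬Sw Su) ; u (there u∈L) Su → covers u u∈L Su } }
        where
        rec = extend L b independent b⊆S
        open IndependentExtension rec

    hasFDim : Σ ℕ (HasFDim S)
    hasFDim = size , basis , independent ,
      λ w → mk⇔ (covers w (complete w)) λ { (cs , refl) → IsFSubspace.Flincomb-closed S-sub basis basis⊆S cs }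
      where
      complete = proj₂ (proj₂ (enumerateVec K.enumeration m))
      greedy : IndependentExtension (proj₁ (enumerateVec K.enumeration m)) []
      greedy = extend _ [] (λ { [] _ → refl }) λ ()
      open IndependentExtension greedy

  count-HasFDim : ∀ {m} {S : Vec K.Carrier m → Set} {d} → HasFDim S d → Count S (card F ^ d)
  count-HasFDim {d = d} (b , independent , S⇔span) =
    count-map (λ cs → Flincomb cs b) (λ _ _ → Flincomb-injective independent _ _)
      (λ w → mk⇔ (λ Sw → let cs , e = to (S⇔span w) Sw in cs , tt , e)
                 (λ (cs , _ , e) → from (S⇔span w) (cs , e)))
      (subst (Count _) (length-enumerateVec F.enumeration d) (count-all (enumerateVec F.enumeration d)))

  HasFDim-unique : ∀ {m} {S : Vec K.Carrier m → Set} {d d′} → HasFDim S d → HasFDim S d′ → d ≡ d′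
  HasFDim-unique dim dim′ = ^-injective F.2≤card (count-unique (count-HasFDim dim) (count-HasFDim dim′))

  HasFDim-cong : ∀ {m} {S T : Vec K.Carrier m → Set} {d} → (∀ w → S w ⇔ T w) → HasFDim S d → HasFDim T d
  HasFDim-cong S⇔T (b , independent , S⇔span) =
    b , independent , λ w → mk⇔ (to (S⇔span w) ∘ from (S⇔T w)) (to (S⇔T w) ∘ from (S⇔span w))

  HasFDim-0⇒≡0v : ∀ {m} {S : Vec K.Carrier m → Set} → HasFDim S 0 → ∀ {w} → S w → w ≡ 0v
  HasFDim-0⇒≡0v ([] , _ , S⇔span) {w} Sw with to (S⇔span w) Sw
  ... | [] , e = sym e

  lookup∈FSpan : ∀ {m d} (vs : Vec (Vec K.Carrier m) d) j → InFSpan (lookup vs j) vs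
  lookup∈FSpan (v ∷ vs) zero    = InFSpan-head v vs
  lookup∈FSpan (v ∷ vs) (suc j) = InFSpan-∷ v (lookup∈FSpan vs j)

  zero-isFSubspace : ∀ {m} → IsFSubspace {m} (_≡ 0v)
  zero-isFSubspace = record
    { 0∈        = refl
    ; ⊕-closed  = λ { refl refl → ⊕-identityˡ 0v }
    ; ι⊙-closed = λ { c refl → ⊙-zeroʳ (ι c) }
    }

  ≡0v-by-lookup : ∀ {n} (c : Vec K.Carrier n) → (∀ j → lookup c j ≡ K.0#) → c ≡ 0v
  ≡0v-by-lookup []      _    = refl
  ≡0v-by-lookup (a ∷ c) c≡0 = cong₂ _∷_ (c≡0 zero) (≡0v-by-lookup c (c≡0 ∘ suc))

  rankWeight-0⇒≡0v : ∀ {n} (c : Vec K.Carrier n) → RankWeight c 0 → c ≡ 0v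
  rankWeight-0⇒≡0v c rw = ≡0v-by-lookup c λ j →
    cong V.head (trans (sym (V.lookup-map j (_∷ []) c)) (HasFDim-0⇒≡0v rw (lookup∈FSpan (coords c) j)))

  rankWeight-0v : ∀ {n w} → RankWeight (0v {n}) w → w ≡ 0
  rankWeight-0v {n} rw = ^-injective F.2≤card (count-unique (count-HasFDim rw)
    (count-cong (λ z → mk⇔ (λ { refl → IsFSubspace.0∈ (FSpan-isFSubspace (coords (0v {n}))) })
                           (λ { (cs , refl) → IsFSubspace.Flincomb-closed zero-isFSubspace _ coords≡0 cs }))
      (count-singleton 0v)))
    where
    coords≡0 : ∀ j → lookup (coords (0v {n})) j ≡ 0v
    coords≡0 j = trans (V.lookup-map j (_∷ []) (0v {n})) (cong (_∷ []) (V.lookup-replicate j K.0#))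

  rankWeight-exists : ∀ {n} (c : Vec K.Carrier n) → Σ ℕ (RankWeight c)
  rankWeight-exists c = hasFDim (λ w → InFSpan? w (coords c)) (FSpan-isFSubspace (coords c))

  -- Points of PG(1, K)

  V2 : Set
  V2 = Vec K.Carrier 2

  OnPoint-refl : ∀ v → OnPoint v v
  OnPoint-refl v = K.1# , sym (⊙-identityˡ v)

  OnPoint-trans : ∀ {v w u} → OnPoint v w → OnPoint w u → OnPoint v u
  OnPoint-trans {v} (a , refl) (b , refl) = b K.* a , sym (⊙-assoc b a v)

  OnPoint-scaled : ∀ {a b u v} → a ≢ K.0# → a ⊙ u ≡ b ⊙ v → OnPoint v u
  OnPoint-scaled {a} {b} {u} {v} a≢0 au≡bv = a⁻¹ K.* b , (begin
    u                    ≡⟨ sym (⊙-identityˡ u) ⟩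
    K.1# ⊙ u             ≡⟨ cong (_⊙ u) (sym a⁻¹a≡1) ⟩
    (a⁻¹ K.* a) ⊙ u      ≡⟨ ⊙-assoc a⁻¹ a u ⟩
    a⁻¹ ⊙ (a ⊙ u)        ≡⟨ cong (a⁻¹ ⊙_) au≡bv ⟩
    a⁻¹ ⊙ (b ⊙ v)        ≡⟨ sym (⊙-assoc a⁻¹ b v) ⟩
    (a⁻¹ K.* b) ⊙ v      ∎)
    where
    open ≡-Reasoning
    a⁻¹ = proj₁ (K.inverse a a≢0)
    a⁻¹a≡1 = trans (K.*-comm a⁻¹ a) (proj₂ (K.inverse a a≢0))

  OnPoint-sym : ∀ {v w} → w ≢ 0v → OnPoint v w → OnPoint w v
  OnPoint-sym {v} w≢0 (a , refl) = OnPoint-scaled a≢0 (sym (⊙-identityˡ (a ⊙ v)))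
    where
    a≢0 : a ≢ K.0#
    a≢0 refl = w≢0 (⊙-zeroˡ v)

  OnPoint-isFSubspace : ∀ v → IsFSubspace (OnPoint v)
  OnPoint-isFSubspace v = record
    { 0∈        = K.0# , sym (⊙-zeroˡ v)
    ; ⊕-closed  = λ { (a , refl) (b , refl) → a K.+ b , sym (⊙-distribʳ-+ a b v) }
    ; ι⊙-closed = λ { c (a , refl) → ι c K.* a , sym (⊙-assoc (ι c) a v) }
    }

  OnPoint? : ∀ v → Decidable (OnPoint v)
  OnPoint? v u = ∃? K.enumeration (λ a → u ≟ᵛ (a ⊙ v))

  count-nonzero-scalars : Count (_≢ K.0#) (card K ∸ 1)
  count-nonzero-scalars = count-cong (λ _ → mk⇔ proj₂ (tt ,_))
    (count-remove K.0# (K._≟ K.0#) tt (count-all K.enumeration))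

  count-point : ∀ {w} → w ≢ 0v → Count (λ x → x ≢ 0v × OnPoint w x) (card K ∸ 1)
  count-point {w} w≢0 = count-map (_⊙ w) (λ _ _ → ⊙-cancelʳ _ _ w w≢0)
    (λ x → mk⇔ (λ { (x≢0 , a , refl) → a , (λ { refl → x≢0 (⊙-zeroˡ w) }) , refl })
               (λ { (a , a≢0 , refl) → (a≢0 ∘ a⊙u≡0⇒a≡0 a w w≢0) , a , refl }))
    count-nonzero-scalars

  -- x₀u₀ + x₁u₁, written in the shape that Klincomb produces: the coordinate of the codeword
  -- Klincomb x G at a column u of G is then definitionally dot x u.
  dot : V2 → V2 → K.Carrier
  dot (x₀ ∷ x₁ ∷ []) (u₀ ∷ u₁ ∷ []) = x₀ K.* u₀ K.+ (x₁ K.* u₁ K.+ K.0#)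

  perp : V2 → V2
  perp (x₀ ∷ x₁ ∷ []) = x₁ ∷ K.- x₀ ∷ []

  rot : V2 → V2
  rot (v₀ ∷ v₁ ∷ []) = K.- v₁ ∷ v₀ ∷ []

  perp-rot : ∀ v → perp (rot v) ≡ v
  perp-rot (v₀ ∷ v₁ ∷ []) = cong (λ t → v₀ ∷ t ∷ []) (K.-‿involutive v₁)

  rot-perp : ∀ v → rot (perp v) ≡ v
  rot-perp (v₀ ∷ v₁ ∷ []) = cong (λ t → t ∷ v₁ ∷ []) (K.-‿involutive v₀)

  perp-⊙ : ∀ a v → perp (a ⊙ v) ≡ a ⊙ perp v
  perp-⊙ a (v₀ ∷ v₁ ∷ []) = cong (λ t → a K.* v₁ ∷ t ∷ []) (K.-‿distribʳ-* a v₀)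

  rot-⊙ : ∀ a v → rot (a ⊙ v) ≡ a ⊙ rot v
  rot-⊙ a (v₀ ∷ v₁ ∷ []) = cong (λ t → t ∷ a K.* v₀ ∷ []) (K.-‿distribʳ-* a v₁)

  perp-nonzero : ∀ {x} → x ≢ 0v → perp x ≢ 0v
  perp-nonzero {x} x≢0 perp≡0 =
    x≢0 (trans (sym (rot-perp x)) (trans (cong rot perp≡0) (cong (λ t → t ∷ K.0# ∷ []) K.-0#≈0#)))

  rot-nonzero : ∀ {v} → v ≢ 0v → rot v ≢ 0v
  rot-nonzero {v} v≢0 rot≡0 =
    v≢0 (trans (sym (perp-rot v)) (trans (cong perp rot≡0) (cong (λ t → K.0# ∷ t ∷ []) K.-0#≈0#)))

  OnPoint-perp⇔rot : ∀ v x → OnPoint v (perp x) ⇔ OnPoint (rot v) x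
  OnPoint-perp⇔rot v x = mk⇔
    (λ (a , e) → a , trans (sym (rot-perp x)) (trans (cong rot e) (rot-⊙ a v)))
    (λ { (a , refl) → a , trans (perp-⊙ a (rot v)) (cong (a ⊙_) (perp-rot v)) })

  dot-comm : ∀ x u → dot x u ≡ dot u x
  dot-comm (x₀ ∷ x₁ ∷ []) (u₀ ∷ u₁ ∷ []) =
    cong₂ (λ s t → s K.+ (t K.+ K.0#)) (K.*-comm x₀ u₀) (K.*-comm x₁ u₁)

  dot-⊕ʳ : ∀ x u w → dot x (u ⊕ w) ≡ dot x u K.+ dot x w
  dot-⊕ʳ (x₀ ∷ x₁ ∷ []) (u₀ ∷ u₁ ∷ []) (w₀ ∷ w₁ ∷ []) = begin
    x₀ K.* (u₀ K.+ w₀) K.+ (x₁ K.* (u₁ K.+ w₁) K.+ K.0#)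
      ≡⟨ cong₂ (λ s t → s K.+ (t K.+ K.0#)) (K.distribˡ x₀ u₀ w₀) (K.distribˡ x₁ u₁ w₁) ⟩
    (x₀ K.* u₀ K.+ x₀ K.* w₀) K.+ ((x₁ K.* u₁ K.+ x₁ K.* w₁) K.+ K.0#)
      ≡⟨ cong ((x₀ K.* u₀ K.+ x₀ K.* w₀) K.+_) (trans (K.+-identityʳ _)
           (sym (cong₂ K._+_ (K.+-identityʳ (x₁ K.* u₁)) (K.+-identityʳ (x₁ K.* w₁))))) ⟩
    (x₀ K.* u₀ K.+ x₀ K.* w₀) K.+ ((x₁ K.* u₁ K.+ K.0#) K.+ (x₁ K.* w₁ K.+ K.0#))
      ≡⟨ K.+-interchange _ _ _ _ ⟩
    (x₀ K.* u₀ K.+ (x₁ K.* u₁ K.+ K.0#)) K.+ (x₀ K.* w₀ K.+ (x₁ K.* w₁ K.+ K.0#)) ∎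
    where open ≡-Reasoning

  dot-⊙ʳ : ∀ x a u → dot x (a ⊙ u) ≡ a K.* dot x u
  dot-⊙ʳ (x₀ ∷ x₁ ∷ []) a (u₀ ∷ u₁ ∷ []) = begin
    x₀ K.* (a K.* u₀) K.+ (x₁ K.* (a K.* u₁) K.+ K.0#)
      ≡⟨ cong₂ (λ s t → s K.+ (t K.+ K.0#)) (K.*-lcomm x₀ a u₀) (K.*-lcomm x₁ a u₁) ⟩
    a K.* (x₀ K.* u₀) K.+ (a K.* (x₁ K.* u₁) K.+ K.0#)
      ≡⟨ cong (λ t → a K.* (x₀ K.* u₀) K.+ (a K.* (x₁ K.* u₁) K.+ t)) (sym (K.zeroʳ a)) ⟩
    a K.* (x₀ K.* u₀) K.+ (a K.* (x₁ K.* u₁) K.+ a K.* K.0#)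
      ≡⟨ cong (a K.* (x₀ K.* u₀) K.+_) (sym (K.distribˡ a _ _)) ⟩
    a K.* (x₀ K.* u₀) K.+ a K.* (x₁ K.* u₁ K.+ K.0#)
      ≡⟨ sym (K.distribˡ a _ _) ⟩
    a K.* (x₀ K.* u₀ K.+ (x₁ K.* u₁ K.+ K.0#)) ∎
    where open ≡-Reasoning

  dot-0ʳ : ∀ x → dot x 0v ≡ K.0#
  dot-0ʳ x = trans (cong (dot x) (sym (⊙-zeroˡ 0v))) (trans (dot-⊙ʳ x K.0# 0v) (K.zeroˡ _))

  dot-⊖ʳ : ∀ x u → dot x (⊖ u) ≡ K.- dot x u
  dot-⊖ʳ x u = trans (cong (dot x) (sym (-1⊙u≡⊖u u)))
    (trans (dot-⊙ʳ x (K.- K.1#) u) (K.-1*x≈-x (dot x u)))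

  OnPoint-perp⇒dot≡0 : ∀ {x u} → OnPoint (perp x) u → dot x u ≡ K.0#
  OnPoint-perp⇒dot≡0 {x₀ ∷ x₁ ∷ []} (a , refl) = begin
    dot (x₀ ∷ x₁ ∷ []) (a ⊙ perp (x₀ ∷ x₁ ∷ []))   ≡⟨ dot-⊙ʳ (x₀ ∷ x₁ ∷ []) a _ ⟩
    a K.* (x₀ K.* x₁ K.+ (x₁ K.* K.- x₀ K.+ K.0#))  ≡⟨ cong (λ t → a K.* (x₀ K.* x₁ K.+ t)) x₁[-x₀]+0≡-x₀x₁ ⟩
    a K.* (x₀ K.* x₁ K.- x₀ K.* x₁)                 ≡⟨ cong (a K.*_) (K.-‿inverseʳ (x₀ K.* x₁)) ⟩
    a K.* K.0#                                      ≡⟨ K.zeroʳ a ⟩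
    K.0#                                            ∎
    where
    open ≡-Reasoning
    x₁[-x₀]+0≡-x₀x₁ : x₁ K.* K.- x₀ K.+ K.0# ≡ K.- (x₀ K.* x₁)
    x₁[-x₀]+0≡-x₀x₁ = trans (K.+-identityʳ _)
      (trans (sym (K.-‿distribʳ-* x₁ x₀)) (cong K.-_ (K.*-comm x₁ x₀)))

  dot≡0⇒OnPoint-perp : ∀ {x u} → x ≢ 0v → dot x u ≡ K.0# → OnPoint (perp x) u
  dot≡0⇒OnPoint-perp {x₀ ∷ x₁ ∷ []} {u₀ ∷ u₁ ∷ []} x≢0 dot≡0 =
    by-cases (x₀ K.≟ K.0#) (x₁ K.≟ K.0#)
    where
    x₀u₀+x₁u₁≡0 : x₀ K.* u₀ K.+ x₁ K.* u₁ ≡ K.0#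
    x₀u₀+x₁u₁≡0 = trans (cong (x₀ K.* u₀ K.+_) (sym (K.+-identityʳ _))) dot≡0
    by-cases : Dec (x₀ ≡ K.0#) → Dec (x₁ ≡ K.0#) → OnPoint (perp (x₀ ∷ x₁ ∷ [])) (u₀ ∷ u₁ ∷ [])
    by-cases (no x₀≢0) _ = OnPoint-scaled x₀≢0 (cong₂ (λ s t → s ∷ t ∷ []) e₀ e₁)
      where
      e₀ : x₀ K.* u₀ ≡ K.- u₁ K.* x₁
      e₀ = trans (K.+-inverseˡ-unique _ _ x₀u₀+x₁u₁≡0)
        (trans (cong K.-_ (K.*-comm x₁ u₁)) (K.-‿distribˡ-* u₁ x₁))
      e₁ : x₀ K.* u₁ ≡ K.- u₁ K.* K.- x₀
      e₁ = trans (K.*-comm x₀ u₁) (sym (K.-x*-y≡x*y u₁ x₀))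
    by-cases _ (no x₁≢0) = OnPoint-scaled x₁≢0 (cong₂ (λ s t → s ∷ t ∷ []) (K.*-comm x₁ u₀) e₁)
      where
      e₁ : x₁ K.* u₁ ≡ u₀ K.* K.- x₀
      e₁ = trans (K.+-inverseʳ-unique _ _ x₀u₀+x₁u₁≡0)
        (trans (cong K.-_ (K.*-comm x₀ u₀)) (K.-‿distribʳ-* u₀ x₀))
    by-cases (yes refl) (yes refl) = ⊥-elim (x≢0 refl)

  e₁ e₂ : V2
  e₁ = K.1# ∷ K.0# ∷ []
  e₂ = K.0# ∷ K.1# ∷ []

  e₁≢0v : e₁ ≢ 0v
  e₁≢0v = K.1≢0 ∘ cong V.head

  ¬OnPoint-e₁×e₂ : ∀ {v} → OnPoint v e₁ → OnPoint v e₂ → ⊥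
  ¬OnPoint-e₁×e₂ {v₀ ∷ v₁ ∷ []} (a , e₁≡av) (b , e₂≡bv) = K.1≢0 (begin
    K.1#         ≡⟨ cong (V.head ∘ V.tail) e₂≡bv ⟩
    b K.* v₁     ≡⟨ cong (K._* v₁) b≡0 ⟩
    K.0# K.* v₁  ≡⟨ K.zeroˡ v₁ ⟩
    K.0#         ∎)
    where
    open ≡-Reasoning
    v₀≢0 : v₀ ≢ K.0#
    v₀≢0 refl = K.1≢0 (trans (cong V.head e₁≡av) (K.zeroʳ a))
    b≡0 : b ≡ K.0#
    b≡0 = K.x*y≡0⇒y≡0 v₀≢0 (trans (K.*-comm v₀ b) (sym (cong V.head e₂≡bv)))

  Klincomb-OnPoint : ∀ {v d} (as : Vec K.Carrier d) (us : Vec V2 d) →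
    (∀ j → OnPoint v (lookup us j)) → OnPoint v (Klincomb as us)
  Klincomb-OnPoint {v} [] [] _ = IsFSubspace.0∈ (OnPoint-isFSubspace v)
  Klincomb-OnPoint {v} (a ∷ as) (u ∷ us) us-on with us-on zero | Klincomb-OnPoint as us (us-on ∘ suc)
  ... | b , refl | c , e = a K.* b K.+ c , (begin
    (a ⊙ (b ⊙ v)) ⊕ Klincomb as us   ≡⟨ cong₂ _⊕_ (sym (⊙-assoc a b v)) e ⟩
    ((a K.* b) ⊙ v) ⊕ (c ⊙ v)        ≡⟨ sym (⊙-distribʳ-+ (a K.* b) c v) ⟩
    (a K.* b K.+ c) ⊙ v              ∎)
    where open ≡-Reasoning

  KSpansAll⇒¬OnPoint : ∀ {S : V2 → Set} → KSpansAll S → ∀ v → ¬ (∀ {u} → S u → OnPoint v u)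
  KSpansAll⇒¬OnPoint spans v S⊆v = ¬OnPoint-e₁×e₂ (on e₁) (on e₂)
    where
    on : ∀ w → OnPoint v w
    on w with spans w
    ... | _ , us , us∈S , as , refl = Klincomb-OnPoint as us (S⊆v ∘ us∈S)

  lookup-codeword : ∀ {n} (G : Gen n) x j → lookup (Klincomb x G) j ≡ dot x (lookup (columns G) j)
  lookup-codeword ((a ∷ r₀) ∷ (b ∷ r₁) ∷ []) (x₀ ∷ x₁ ∷ []) zero    = refl
  lookup-codeword ((a ∷ r₀) ∷ (b ∷ r₁) ∷ []) x@(_ ∷ _ ∷ []) (suc j) = lookup-codeword (r₀ ∷ r₁ ∷ []) x j

  Flincomb-coords-codeword : ∀ {n} (G : Gen n) x (cs : Vec F.Carrier n) →
    Flincomb cs (coords (Klincomb x G)) ≡ dot x (Flincomb cs (columns G)) ∷ []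
  Flincomb-coords-codeword ([] ∷ [] ∷ []) x@(_ ∷ _ ∷ []) [] = cong (_∷ []) (sym (dot-0ʳ x))
  Flincomb-coords-codeword ((a ∷ r₀) ∷ (b ∷ r₁) ∷ []) x@(_ ∷ _ ∷ []) (c ∷ cs) = begin
    (ι c ⊙ (dot x col ∷ [])) ⊕ Flincomb cs (coords (Klincomb x G′))
      ≡⟨ cong ((ι c ⊙ (dot x col ∷ [])) ⊕_) (Flincomb-coords-codeword G′ x cs) ⟩
    ι c K.* dot x col K.+ dot x rest ∷ []
      ≡⟨ cong (λ t → t K.+ dot x rest ∷ []) (sym (dot-⊙ʳ x (ι c) col)) ⟩
    dot x (ι c ⊙ col) K.+ dot x rest ∷ []
      ≡⟨ cong (_∷ []) (sym (dot-⊕ʳ x (ι c ⊙ col) rest)) ⟩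
    dot x ((ι c ⊙ col) ⊕ rest) ∷ [] ∎
    where
    open ≡-Reasoning
    G′ = r₀ ∷ r₁ ∷ []
    col = a ∷ b ∷ []
    rest = Flincomb cs (columns G′)

  ColumnsOnPoint : ∀ {n} → Gen n → V2 → Set
  ColumnsOnPoint G v = ∀ j → OnPoint v (lookup (columns G) j)

  KRank2⇒¬ColumnsOnPoint : ∀ {n} {G : Gen n} → KRank2 G → ∀ {v} → v ≢ 0v → ¬ ColumnsOnPoint G v
  KRank2⇒¬ColumnsOnPoint {G = G} rank2 {v} v≢0 on = rot-nonzero v≢0 (rank2 (rot v)
    (≡0v-by-lookup _ λ j → trans (lookup-codeword G (rot v) j)
      (OnPoint-perp⇒dot≡0 (subst (λ w → OnPoint w _) (sym (perp-rot v)) (on j)))))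

  ¬ColumnsOnPoint⇒KRank2 : ∀ {n} {G : Gen n} → (∀ {v} → v ≢ 0v → ¬ ColumnsOnPoint G v) → KRank2 G
  ¬ColumnsOnPoint⇒KRank2 {G = G} ¬on x xG≡0 with x ≟ᵛ 0v
  ... | yes x≡0 = x≡0
  ... | no x≢0  = ⊥-elim (¬on (perp-nonzero x≢0) λ j → dot≡0⇒OnPoint-perp x≢0 (begin
    dot x (lookup (columns G) j)  ≡⟨ sym (lookup-codeword G x j) ⟩
    lookup (Klincomb x G) j       ≡⟨ cong (λ c → lookup c j) xG≡0 ⟩
    lookup 0v j                   ≡⟨ V.lookup-replicate j K.0# ⟩
    K.0#                          ∎))
    where open ≡-Reasoning

  KSpansAll⇒KRank2 : ∀ {n} {G : Gen n} → KSpansAll (System G) → KRank2 G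
  KSpansAll⇒KRank2 {G = G} spans = ¬ColumnsOnPoint⇒KRank2 λ {v} _ on →
    KSpansAll⇒¬OnPoint {System G} spans v λ { (cs , refl) →
      IsFSubspace.Flincomb-closed (OnPoint-isFSubspace v) (columns G) on cs }

  KRank2⇒2≤n : ∀ {n} {G : Gen n} → KRank2 G → 2 ≤ n
  KRank2⇒2≤n {zero} rank2 = ⊥-elim (KRank2⇒¬ColumnsOnPoint rank2 e₁≢0v λ ())
  KRank2⇒2≤n {suc zero} {G@((a ∷ []) ∷ (b ∷ []) ∷ [])} rank2 with (a ∷ b ∷ []) ≟ᵛ 0v
  ... | yes col≡0 = ⊥-elim (KRank2⇒¬ColumnsOnPoint rank2 e₁≢0v
          λ { zero → subst (OnPoint e₁) (sym col≡0) (IsFSubspace.0∈ (OnPoint-isFSubspace e₁)) })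
  ... | no col≢0  = ⊥-elim (KRank2⇒¬ColumnsOnPoint rank2 col≢0 λ { zero → OnPoint-refl _ })
  KRank2⇒2≤n {suc (suc n)} _ = s≤s (s≤s z≤n)

  module _ {n} (G : Gen n) where

    private
      U = System G
      q = card F

    System? : Decidable U
    System? u = InFSpan? u (columns G)

    DotImage : V2 → K.Carrier → Set
    DotImage x y = ∃ λ u → U u × dot x u ≡ y

    DotImage? : ∀ x → Decidable (DotImage x)
    DotImage? x y = ∃? (enumerateVec K.enumeration 2) (λ u → System? u ×-dec (dot x u K.≟ y))

    count-DotImage : ∀ x {w} → RankWeight (Klincomb x G) w → Count (DotImage x) (q ^ w)
    count-DotImage x rw = count-map V.head (λ { {_ ∷ []} {_ ∷ []} _ _ refl → refl })
      (λ y → mk⇔ (λ { (u , (cs , refl) , refl) → _ , (cs , Flincomb-coords-codeword G x cs) , refl })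
                 (λ { (_ , (cs , e) , refl) → Flincomb cs (columns G) , (cs , refl) ,
                        cong V.head (trans (sym (Flincomb-coords-codeword G x cs)) e) }))
      (count-HasFDim rw)

    count-dot-fibre : ∀ {x p} → x ≢ 0v → PointWeight U (perp x) p →
      ∀ y → Count (λ u → U u × dot x u ≡ y) (indicator (DotImage? x y) (q ^ p))
    count-dot-fibre {x} x≢0 pw y with DotImage? x y
    ... | no ∉image = count-empty λ u fibre → ∉image (u , fibre)
    ... | yes (u₀ , Uu₀ , dot≡y) = count-map (u₀ ⊕_) (λ _ _ → ⊕-cancelˡ u₀ _ _)
      (λ u → mk⇔ (λ (Uu , dot≡y′) → u ⊕ (⊖ u₀) , kernel (Uu , dot≡y′) , translate u)
                 (λ { (z , (Uz , dotz≡0) , refl) → U.⊕-closed Uu₀ Uz ,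
                      trans (dot-⊕ʳ x u₀ z) (trans (cong₂ K._+_ dot≡y dotz≡0) (K.+-identityʳ y)) }))
      (count-cong (λ u → mk⇔ (λ (Uu , on) → Uu , OnPoint-perp⇒dot≡0 on)
                             (λ (Uu , dot≡0) → Uu , dot≡0⇒OnPoint-perp x≢0 dot≡0))
        (count-HasFDim pw))
      where
      module U = IsFSubspace (FSpan-isFSubspace (columns G))
      kernel : ∀ {u} → U u × dot x u ≡ y → U (u ⊕ (⊖ u₀)) × dot x (u ⊕ (⊖ u₀)) ≡ K.0#
      kernel {u} (Uu , dot≡y′) = U.⊕-closed Uu (U.⊖-closed Uu₀) , (begin
        dot x (u ⊕ (⊖ u₀))          ≡⟨ dot-⊕ʳ x u (⊖ u₀) ⟩
        dot x u K.+ dot x (⊖ u₀)    ≡⟨ cong₂ K._+_ dot≡y′ (trans (dot-⊖ʳ x u₀) (cong K.-_ dot≡y)) ⟩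
        y K.- y                     ≡⟨ K.-‿inverseʳ y ⟩
        K.0#                        ∎)
        where open ≡-Reasoning
      translate : ∀ u → u₀ ⊕ (u ⊕ (⊖ u₀)) ≡ u
      translate u = begin
        u₀ ⊕ (u ⊕ (⊖ u₀))    ≡⟨ cong (u₀ ⊕_) (⊕-comm u (⊖ u₀)) ⟩
        u₀ ⊕ ((⊖ u₀) ⊕ u)    ≡⟨ sym (⊕-assoc u₀ (⊖ u₀) u) ⟩
        (u₀ ⊕ (⊖ u₀)) ⊕ u    ≡⟨ cong (_⊕ u) (⊕-inverseʳ u₀) ⟩
        0v ⊕ u               ≡⟨ ⊕-identityˡ u ⟩
        u                    ∎
        where open ≡-Reasoning

    rankWeight+pointWeight≡n : Count U (q ^ n) → ∀ {x w p} → x ≢ 0v →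
      RankWeight (Klincomb x G) w → PointWeight U (perp x) p → w + p ≡ n
    rankWeight+pointWeight≡n count-U {x} {w} {p} x≢0 rw pw = sym (^-injective F.2≤card (begin
      q ^ n                                                   ≡⟨ count-unique count-U by-fibres ⟩
      sum (L.map (λ y → indicator (DotImage? x y) (q ^ p)) Ks) ≡⟨ sum-indicator (DotImage? x) (q ^ p) Ks ⟩
      length (filter (DotImage? x) Ks) * q ^ p               ≡⟨ cong (_* q ^ p) image-size ⟩
      q ^ w * q ^ p                                           ≡⟨ sym (ℕ.^-distribˡ-+-* q w p) ⟩
      q ^ (w + p)                                             ∎))
      where
      open ≡-Reasoning
      Ks = proj₁ K.enumeration
      by-fibres = count-by-fibres K.enumeration (dot x) _ (count-dot-fibre x≢0 pw)
      image-size = count-unique (count-filter K.enumeration (DotImage? x)) (count-DotImage x rw)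

    module Weights (count-U : Count U (q ^ n)) where

      pointWeight-exists : ∀ v → Σ ℕ (PointWeight U v)
      pointWeight-exists v = hasFDim (λ u → System? u ×-dec OnPoint? v u)
        (∩-isFSubspace (FSpan-isFSubspace (columns G)) (OnPoint-isFSubspace v))

      pointWeight : V2 → ℕ
      pointWeight v = proj₁ (pointWeight-exists v)

      pointWeight-spec : ∀ v → PointWeight U v (pointWeight v)
      pointWeight-spec v = proj₂ (pointWeight-exists v)

      pointWeight-unique : ∀ {v p} → PointWeight U v p → pointWeight v ≡ p
      pointWeight-unique = HasFDim-unique (pointWeight-spec _)

      PointWeight-samePoint : ∀ {v v′ p} → v′ ≢ 0v → OnPoint v v′ → PointWeight U v p → PointWeight U v′ p
      PointWeight-samePoint v′≢0 v′∈v = HasFDim-cong λ u →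
        mk⇔ (λ (Uu , u∈v) → Uu , OnPoint-trans (OnPoint-sym v′≢0 v′∈v) u∈v)
            (λ (Uu , u∈v′) → Uu , OnPoint-trans v′∈v u∈v′)

      pointWeight-sameLine : ∀ {x y} → x ≢ 0v → OnPoint y x → pointWeight (perp x) ≡ pointWeight (perp y)
      pointWeight-sameLine {x} {y} x≢0 (a , refl) = pointWeight-unique
        (PointWeight-samePoint (perp-nonzero x≢0) (a , perp-⊙ a y) (pointWeight-spec (perp y)))

      codeword-rankWeight : ∀ {x W} → x ≢ 0v → W + pointWeight (perp x) ≡ n → RankWeight (Klincomb x G) W
      codeword-rankWeight {x} {W} x≢0 e with rankWeight-exists (Klincomb x G)
      ... | w , rw = subst (RankWeight (Klincomb x G))
        (ℕ.+-cancelʳ-≡ _ w W (trans (rankWeight+pointWeight≡n count-U x≢0 rw (pointWeight-spec _)) (sym e))) rw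

      codeword-pointWeight : ∀ {x W p} → x ≢ 0v → W + p ≡ n → RankWeight (Klincomb x G) W →
        pointWeight (perp x) ≡ p
      codeword-pointWeight x≢0 e rw =
        ℕ.+-cancelˡ-≡ _ _ _ (trans (rankWeight+pointWeight≡n count-U x≢0 rw (pointWeight-spec _)) (sym e))

      count-codewords : KRank2 G → ∀ {W p N} → W + p ≡ n → 1 ≤ W →
        Count (λ x → x ≢ 0v × pointWeight (perp x) ≡ p) N → Count (λ c → InCode G c × RankWeight c W) N
      count-codewords rank2 {W} {p} e 1≤W = count-map (λ x → Klincomb x G)
        (λ _ _ → Klincomb-injective rank2 _ _)
        (λ c → mk⇔ into λ { (x , (x≢0 , pw≡p) , refl) → (x , refl) ,
                              codeword-rankWeight x≢0 (trans (cong (W +_) pw≡p) e) })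
        where
        into : ∀ {c} → InCode G c × RankWeight c W →
          ∃ λ x → (x ≢ 0v × pointWeight (perp x) ≡ p) × Klincomb x G ≡ c
        into ((x , refl) , rw) with x ≟ᵛ 0v
        ... | yes refl = ⊥-elim (ℕ.<⇒≢ 1≤W (sym (rankWeight-0v (subst (λ c → RankWeight c W) (Klincomb-0 G) rw))))
        ... | no x≢0   = x , (x≢0 , codeword-pointWeight x≢0 e rw) , refl

      V2s : List V2
      V2s = proj₁ (enumerateVec K.enumeration 2)

      -- Double count of the pairs (x, u) with x ≢ 0, u ∈ U ∖ {0} and dot x u ≡ 0: for fixed x
      -- they are the nonzero vectors of U on the point ⟨perp x⟩, for fixed u the nonzero x on ⟨perp u⟩.
      sum-pointWeights : sum (L.map (λ x → indicator (¬? (x ≟ᵛ 0v)) (q ^ pointWeight (perp x) ∸ 1)) V2s)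
                       ≡ (q ^ n ∸ 1) * (card K ∸ 1)
      sum-pointWeights = begin
        sum (L.map (λ x → indicator (¬? (x ≟ᵛ 0v)) (q ^ pointWeight (perp x) ∸ 1)) V2s)
          ≡⟨ count-unique (count-by-fibres (enumerateVec K.enumeration 2) proj₁ _ fibre-x)
                          (count-by-fibres (enumerateVec K.enumeration 2) proj₂ _ fibre-u) ⟩
        sum (L.map (λ u → indicator (U∖0? u) (card K ∸ 1)) V2s)
          ≡⟨ sum-indicator U∖0? (card K ∸ 1) V2s ⟩
        length (filter U∖0? V2s) * (card K ∸ 1)
          ≡⟨ cong (_* (card K ∸ 1)) (count-unique (count-filter (enumerateVec K.enumeration 2) U∖0?)
                                                (count-remove 0v (_≟ᵛ 0v) U-0∈ count-U)) ⟩
        (q ^ n ∸ 1) * (card K ∸ 1) ∎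
        where
        open ≡-Reasoning
        Orthogonal : V2 × V2 → Set
        Orthogonal (x , u) = x ≢ 0v × (U u × u ≢ 0v) × dot x u ≡ K.0#
        U∖0? : Decidable (λ u → U u × u ≢ 0v)
        U∖0? u = System? u ×-dec ¬? (u ≟ᵛ 0v)
        U-0∈ = IsFSubspace.0∈ (FSpan-isFSubspace (columns G))
        fibre-x : ∀ x → Count (λ pair → Orthogonal pair × proj₁ pair ≡ x)
                              (indicator (¬? (x ≟ᵛ 0v)) (q ^ pointWeight (perp x) ∸ 1))
        fibre-x x with ¬? (x ≟ᵛ 0v)
        ... | no x≡0 = count-empty λ { _ ((x≢0 , _) , refl) → x≡0 x≢0 }
        ... | yes x≢0 = count-map (x ,_) (λ _ _ → cong proj₂)
          (λ { (x′ , u) → mk⇔ (λ { ((_ , Uu∖0 , dot≡0) , refl) → u , (Uu∖0 , dot≡0) , refl })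
                              (λ { (u , (Uu∖0 , dot≡0) , refl) → (x≢0 , Uu∖0 , dot≡0) , refl }) })
          (count-cong (λ u → mk⇔ (λ ((Uu , on) , u≢0) → (Uu , u≢0) , OnPoint-perp⇒dot≡0 on)
                                 (λ ((Uu , u≢0) , dot≡0) → (Uu , dot≡0⇒OnPoint-perp x≢0 dot≡0) , u≢0))
            (count-remove 0v (_≟ᵛ 0v) (U-0∈ , IsFSubspace.0∈ (OnPoint-isFSubspace (perp x)))
              (count-HasFDim (pointWeight-spec (perp x)))))
        fibre-u : ∀ u → Count (λ pair → Orthogonal pair × proj₂ pair ≡ u) (indicator (U∖0? u) (card K ∸ 1))
        fibre-u u with U∖0? u
        ... | no ∉U∖0 = count-empty λ { _ ((_ , Uu∖0 , _) , refl) → ∉U∖0 Uu∖0 }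
        ... | yes Uu∖0@(_ , u≢0) = count-map (_, u) (λ _ _ → cong proj₁)
          (λ { (x , u′) → mk⇔
            (λ { ((x≢0 , _ , dot≡0) , refl) →
                   x , (x≢0 , dot≡0⇒OnPoint-perp u≢0 (trans (dot-comm u x) dot≡0)) , refl })
            (λ { (x , (x≢0 , on) , refl) → (x≢0 , Uu∖0 , trans (dot-comm x u) (OnPoint-perp⇒dot≡0 on)) , refl }) })
          (count-point (perp-nonzero u≢0))

      Class : ℕ → V2 → Set
      Class p x = x ≢ 0v × pointWeight (perp x) ≡ p

      Class? : ∀ p → Decidable (Class p)
      Class? p x = ¬? (x ≟ᵛ 0v) ×-dec (pointWeight (perp x) ℕ.≟ p)

      classSize : ℕ → ℕ
      classSize p = length (filter (Class? p) V2s)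

      count-Class : ∀ p → Count (Class p) (classSize p)
      count-Class p = count-filter (enumerateVec K.enumeration 2) (Class? p)

  -- From an i-club to the weight distribution

  module ClubToDistribution {n i} (card-K : card K ≡ card F ^ n) (1≤i : 1 ≤ i) (G : Gen n)
           (dim-U : HasFDim (System G) n) (spans : KSpansAll (System G)) (club : IsClub (System G) i) where

    private
      q = card F
      U = System G
      count-U : Count U (q ^ n)
      count-U = count-HasFDim dim-U
      rank2 : KRank2 G
      rank2 = KSpansAll⇒KRank2 spans
      v = proj₁ club
      v≢0 = proj₁ (proj₂ club)
      weight-v = proj₁ (proj₂ (proj₂ club))
      others-weight≤1 = proj₁ (proj₂ (proj₂ (proj₂ club)))
      weight-i⇒on-v = proj₂ (proj₂ (proj₂ (proj₂ club)))

    open Weights G count-U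

    i≤n : i ≤ n
    i≤n = ^-cancelˡ-≤ F.2≤card (count-mono proj₁ (count-HasFDim weight-v) count-U)

    i≢n : i ≢ n
    i≢n refl = KSpansAll⇒¬OnPoint {U} spans v λ Uu → proj₂
      (⊆∧count≡⇒⊇ (λ u → System? G u ×-dec OnPoint? v u) proj₁ (count-HasFDim weight-v) count-U Uu)

    i≢1 : i ≢ 1
    i≢1 refl = KSpansAll⇒¬OnPoint {U} spans v on-v
      where
      on-v : ∀ {u} → U u → OnPoint v u
      on-v {u} Uu with u ≟ᵛ 0v | OnPoint? v u
      ... | yes refl | _      = IsFSubspace.0∈ (OnPoint-isFSubspace v)
      ... | no _     | yes on = on
      ... | no u≢0   | no off with others-weight≤1 u u≢0 off
      ...   | inj₁ weight-0 = ⊥-elim (u≢0 (HasFDim-0⇒≡0v weight-0 (Uu , OnPoint-refl u)))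
      ...   | inj₂ weight-1 = weight-i⇒on-v u u≢0 weight-1

    2≤i : 2 ≤ i
    2≤i = ℕ.≤∧≢⇒< 1≤i (i≢1 ∘ sym)

    i<n : i < n
    i<n = ℕ.≤∧≢⇒< i≤n i≢n

    2≤n : 2 ≤ n
    2≤n = ℕ.≤-trans 2≤i (ℕ.<⇒≤ i<n)

    weight-i⇔on-rot-v : ∀ {x} → x ≢ 0v → pointWeight (perp x) ≡ i ⇔ OnPoint (rot v) x
    weight-i⇔on-rot-v {x} x≢0 = mk⇔
      (λ weight≡i → to (OnPoint-perp⇔rot v x) (weight-i⇒on-v (perp x) (perp-nonzero x≢0)
                       (subst (PointWeight U (perp x)) weight≡i (pointWeight-spec (perp x)))))
      (λ on → pointWeight-unique (PointWeight-samePoint (perp-nonzero x≢0) (from (OnPoint-perp⇔rot v x) on) weight-v))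

    off-rot-v⇒weight≤1 : ∀ {x} → x ≢ 0v → ¬ OnPoint (rot v) x →
      pointWeight (perp x) ≡ 0 ⊎ pointWeight (perp x) ≡ 1
    off-rot-v⇒weight≤1 {x} x≢0 off with others-weight≤1 (perp x) (perp-nonzero x≢0) (off ∘ to (OnPoint-perp⇔rot v x))
    ... | inj₁ weight-0 = inj₁ (pointWeight-unique weight-0)
    ... | inj₂ weight-1 = inj₂ (pointWeight-unique weight-1)

    classify : ∀ {x} → x ≢ 0v → Class i x ⊎ Class 1 x ⊎ Class 0 x
    classify {x} x≢0 with OnPoint? (rot v) x
    ... | yes on = inj₁ (x≢0 , from (weight-i⇔on-rot-v x≢0) on)
    ... | no off with off-rot-v⇒weight≤1 x≢0 off
    ...   | inj₁ weight-0 = inj₂ (inj₂ (x≢0 , weight-0))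
    ...   | inj₂ weight-1 = inj₂ (inj₁ (x≢0 , weight-1))

    count-Class-i : Count (Class i) (card K ∸ 1)
    count-Class-i = count-cong
      (λ x → mk⇔ (λ (x≢0 , on) → x≢0 , from (weight-i⇔on-rot-v x≢0) on)
                 (λ (x≢0 , weight≡i) → x≢0 , to (weight-i⇔on-rot-v x≢0) weight≡i))
      (count-point (rot-nonzero v≢0))

    partition : (card K ∸ 1) + classSize 1 + classSize 0 ≡ suc (card K ∸ 1) * suc (card K ∸ 1) ∸ 1
    partition = count-unique
      (count-cong (λ x → mk⇔ (λ { (inj₁ (inj₁ (x≢0 , _))) → tt , x≢0 ; (inj₁ (inj₂ (x≢0 , _))) → tt , x≢0
                                ; (inj₂ (x≢0 , _)) → tt , x≢0 })
                             (λ (_ , x≢0) → reassociate (classify x≢0)))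
        (count-⊎ (λ { _ (inj₁ (_ , ≡i)) (_ , ≡0) → ℕ.<⇒≢ 1≤i (trans (sym ≡0) ≡i)
                    ; _ (inj₂ (_ , ≡1)) (_ , ≡0) → ℕ.1+n≢0 (trans (sym ≡1) ≡0) })
          (count-⊎ (λ { _ (_ , ≡i) (_ , ≡1) → i≢1 (trans (sym ≡i) ≡1) }) count-Class-i (count-Class 1))
          (count-Class 0)))
      (subst (Count _) (cong (_∸ 1) (trans (length-enumerateVec K.enumeration 2) card²))
        (count-remove 0v (_≟ᵛ 0v) tt (count-all (enumerateVec K.enumeration 2))))
      where
      reassociate : ∀ {x} → Class i x ⊎ Class 1 x ⊎ Class 0 x → (Class i x ⊎ Class 1 x) ⊎ Class 0 x
      reassociate (inj₁ c)        = inj₁ (inj₁ c)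
      reassociate (inj₂ (inj₁ c)) = inj₁ (inj₂ c)
      reassociate (inj₂ (inj₂ c)) = inj₂ c
      card² : card K ^ 2 ≡ suc (card K ∸ 1) * suc (card K ∸ 1)
      card² = trans (cong (card K *_) (ℕ.*-identityʳ (card K)))
        (cong (λ k → k * k) (sym (ℕ.m+[n∸m]≡n (ℕ.≤-trans (s≤s z≤n) K.2≤card))))

    double-count : (card K ∸ 1) * (q ^ i ∸ 1) + classSize 1 * (q ∸ 1) ≡ (card K ∸ 1) * (card K ∸ 1)
    double-count = begin
      (card K ∸ 1) * (q ^ i ∸ 1) + classSize 1 * (q ∸ 1)
        ≡⟨ cong₂ (λ a b → a * (q ^ i ∸ 1) + classSize 1 * (b ∸ 1))
                 (count-unique count-Class-i (count-Class i)) (sym (ℕ.*-identityʳ q)) ⟩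
      classSize i * (q ^ i ∸ 1) + classSize 1 * (q ^ 1 ∸ 1)
        ≡⟨ sym (cong₂ _+_ (sum-indicator (Class? i) (q ^ i ∸ 1) V2s) (sum-indicator (Class? 1) (q ^ 1 ∸ 1) V2s)) ⟩
      sum (L.map (λ x → indicator (Class? i x) (q ^ i ∸ 1)) V2s)
        + sum (L.map (λ x → indicator (Class? 1 x) (q ^ 1 ∸ 1)) V2s)
        ≡⟨ sym (sum-map-+ (λ x → indicator (Class? i x) (q ^ i ∸ 1)) (λ x → indicator (Class? 1 x) (q ^ 1 ∸ 1)) V2s) ⟩
      sum (L.map (λ x → indicator (Class? i x) (q ^ i ∸ 1) + indicator (Class? 1 x) (q ^ 1 ∸ 1)) V2s)
        ≡⟨ cong sum (map-cong (sym ∘ per-vector) V2s) ⟩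
      sum (L.map (λ x → indicator (¬? (x ≟ᵛ 0v)) (q ^ pointWeight (perp x) ∸ 1)) V2s)
        ≡⟨ sum-pointWeights ⟩
      (q ^ n ∸ 1) * (card K ∸ 1)
        ≡⟨ cong (λ k → (k ∸ 1) * (card K ∸ 1)) (sym card-K) ⟩
      (card K ∸ 1) * (card K ∸ 1) ∎
      where
      open ≡-Reasoning
      contribution : ∀ {x p} → pointWeight (perp x) ≡ p → q ^ pointWeight (perp x) ∸ 1 ≡ q ^ p ∸ 1
      contribution = cong (λ p → q ^ p ∸ 1)
      per-vector : ∀ x → indicator (¬? (x ≟ᵛ 0v)) (q ^ pointWeight (perp x) ∸ 1)
                       ≡ indicator (Class? i x) (q ^ i ∸ 1) + indicator (Class? 1 x) (q ^ 1 ∸ 1)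
      per-vector x with ¬? (x ≟ᵛ 0v) | Class? i x | Class? 1 x
      ... | no x≡0 | yes (x≢0 , _) | _             = ⊥-elim (x≡0 x≢0)
      ... | no x≡0 | no _          | yes (x≢0 , _) = ⊥-elim (x≡0 x≢0)
      ... | no _   | no _          | no _          = refl
      ... | yes _  | yes (_ , ≡i)  | yes (_ , ≡1)  = ⊥-elim (i≢1 (trans (sym ≡i) ≡1))
      ... | yes _  | yes (_ , ≡i)  | no _          = trans (contribution ≡i) (sym (ℕ.+-identityʳ _))
      ... | yes _  | no _          | yes (_ , ≡1)  = contribution ≡1
      ... | yes x≢0 | no ¬i        | no ¬1 with classify x≢0
      ...   | inj₁ c              = ⊥-elim (¬i c)
      ...   | inj₂ (inj₁ c)       = ⊥-elim (¬1 c)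
      ...   | inj₂ (inj₂ (_ , ≡0)) = contribution ≡0

    club⇒weightDistribution :
        Count (λ c → InCode G c × RankWeight c (n ∸ i)) (q ^ n ∸ 1)
      × Count (λ c → InCode G c × RankWeight c (n ∸ 1)) ((q ^ n ∸ 1) * geomSum q i n)
      × Count (λ c → InCode G c × RankWeight c n) ((q ^ n ∸ 1) * (q ^ n ∸ geomSum q i n))
    club⇒weightDistribution =
      count-codewords rank2 (ℕ.m∸n+n≡m i≤n) (ℕ.m<n⇒0<n∸m i<n) (subst (Count _) A≡ count-Class-i) ,
      count-codewords rank2 (ℕ.m∸n+n≡m 1≤n) (ℕ.m<n⇒0<n∸m 2≤n)
        (subst (Count _) (trans N₁≡ (cong (_* g) A≡)) (count-Class 1)) ,
      count-codewords rank2 (ℕ.+-identityʳ n) 1≤n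
        (subst (Count _) (trans N₀≡ (cong₂ _*_ A≡ (cong (_∸ g) sucA≡))) (count-Class 0))
      where
      A = card K ∸ 1
      g = geomSum q i n
      1≤q = ℕ.≤-trans (s≤s z≤n) F.2≤card
      1≤n = ℕ.≤-trans (s≤s z≤n) 2≤n
      sucA≡ : suc A ≡ q ^ n
      sucA≡ = trans (ℕ.m+[n∸m]≡n (ℕ.≤-trans (s≤s z≤n) K.2≤card)) card-K
      A≡ : A ≡ q ^ n ∸ 1
      A≡ = cong (_∸ 1) card-K
      N₁≡ : classSize 1 ≡ A * g
      N₁≡ = count-from-double-count (ℕ.m<n⇒0<n∸m F.2≤card)
        (trans sucA≡ (trans (sym (geomSum-telescope i n 1≤q i≤n))
          (cong (_+ g * (q ∸ 1)) (sym (ℕ.m+[n∸m]≡n (ℕ.m^n>0 q ⦃ >-nonZero 1≤q ⦄ i))))))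
        double-count
      N₀≡ : classSize 0 ≡ A * (suc A ∸ g)
      N₀≡ = count-from-partition partition N₁≡

  -- From the weight distribution to an i-club

  module DistributionToClub {n i} (card-K : card K ≡ card F ^ n)
           (G : Gen n) (rank2 : KRank2 G) (nondegenerate : NonDegenerate G)
           (count-weight-n∸i : Count (λ c → InCode G c × RankWeight c (n ∸ i)) (card F ^ n ∸ 1))
           (three-weights : ∀ c → InCode G c → c ≢ 0v →
                              RankWeight c (n ∸ i) ⊎ RankWeight c (n ∸ 1) ⊎ RankWeight c n) where

    private
      q = card F
      U = System G
      count-U : Count U (q ^ n)
      count-U = count-HasFDim (columns G , nondegenerate , λ _ → mk⇔ id id)
      2≤n = KRank2⇒2≤n rank2

    open Weights G count-U

    1<q^n∸1 : 1 < q ^ n ∸ 1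
    1<q^n∸1 = ℕ.∸-monoˡ-≤ 1 (begin
      3         ≤⟨ ℕ.n≤1+n 3 ⟩
      2 * 2     ≤⟨ ℕ.*-mono-≤ F.2≤card F.2≤card ⟩
      q * q     ≡⟨ cong (q *_) (sym (ℕ.*-identityʳ q)) ⟩
      q ^ 2     ≤⟨ ℕ.^-monoʳ-≤ q ⦃ >-nonZero (ℕ.≤-trans (s≤s z≤n) F.2≤card) ⦄ 2≤n ⟩
      q ^ n     ∎)
      where open ℕ.≤-Reasoning

    i<n : i < n
    i<n with ℕ.<-≤-connex i n
    ... | inj₁ i<n = i<n
    ... | inj₂ n≤i = ⊥-elim (ℕ.<⇒≱ 1<q^n∸1 (count-mono only-zero count-weight-n∸i (count-singleton 0v)))
      where
      only-zero : ∀ {c} → InCode G c × RankWeight c (n ∸ i) → c ≡ 0v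
      only-zero {c} (_ , rw) = rankWeight-0⇒≡0v c (subst (RankWeight c) (ℕ.m≤n⇒m∸n≡0 n≤i) rw)

    weight-split : n ∸ i + i ≡ n
    weight-split = ℕ.m∸n+n≡m (ℕ.<⇒≤ i<n)

    minimal-codeword : ∃ λ x → x ≢ 0v × pointWeight (perp x) ≡ i
    minimal-codeword with count-nonempty count-weight-n∸i (ℕ.≤-trans (s≤s z≤n) 1<q^n∸1)
    ... | _ , (x , refl) , rw = x , x≢0 , codeword-pointWeight x≢0 weight-split rw
      where
      x≢0 : x ≢ 0v
      x≢0 refl = ℕ.<⇒≢ (ℕ.m<n⇒0<n∸m i<n)
        (sym (rankWeight-0v (subst (λ c → RankWeight c (n ∸ i)) (Klincomb-0 G) rw)))

    classSize-i : classSize i ≡ q ^ n ∸ 1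
    classSize-i = count-unique (count-codewords rank2 weight-split (ℕ.m<n⇒0<n∸m i<n) (count-Class i))
                               count-weight-n∸i

    private
      x₀ = proj₁ minimal-codeword
      x₀≢0 = proj₁ (proj₂ minimal-codeword)
      weight-x₀ = proj₂ (proj₂ minimal-codeword)

    -- A second point ⟨v′⟩ of weight i would make the nonzero vectors of ⟨x₀⟩ and of ⟨rot v′⟩
    -- two disjoint sets of |K| − 1 coefficient vectors each with codewords of weight n − i.
    weight-i⇒on-perp-x₀ : ∀ v′ → v′ ≢ 0v → PointWeight U v′ i → OnPoint (perp x₀) v′
    weight-i⇒on-perp-x₀ v′ v′≢0 weight-v′ with OnPoint? (perp x₀) v′
    ... | yes on = on
    ... | no off = ⊥-elim (ℕ.<⇒≱ (ℕ.m<m+n (card K ∸ 1) 1≤|K|-1) (begin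
      (card K ∸ 1) + (card K ∸ 1)   ≤⟨ count-mono two-lines⊆Class-i two-lines (count-Class i) ⟩
      classSize i                   ≡⟨ classSize-i ⟩
      q ^ n ∸ 1                     ≡⟨ cong (_∸ 1) (sym card-K) ⟩
      card K ∸ 1                    ∎))
      where
      open ℕ.≤-Reasoning
      1≤|K|-1 = ℕ.m<n⇒0<n∸m K.2≤card
      disjoint : ∀ x → x ≢ 0v × OnPoint x₀ x → ¬ (x ≢ 0v × OnPoint (rot v′) x)
      disjoint x (x≢0 , x∈x₀) (_ , x∈rot-v′) = off (subst (OnPoint (perp x₀)) (perp-rot v′)
        (from (OnPoint-perp⇔rot (perp x₀) (rot v′)) (subst (λ w → OnPoint w (rot v′)) (sym (rot-perp x₀))
          (OnPoint-trans x∈x₀ (OnPoint-sym x≢0 x∈rot-v′)))))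
      two-lines = count-⊎ disjoint (count-point x₀≢0) (count-point (rot-nonzero v′≢0))
      two-lines⊆Class-i : ∀ {x} → (x ≢ 0v × OnPoint x₀ x) ⊎ (x ≢ 0v × OnPoint (rot v′) x) → Class i x
      two-lines⊆Class-i (inj₁ (x≢0 , x∈x₀)) = x≢0 , trans (pointWeight-sameLine x≢0 x∈x₀) weight-x₀
      two-lines⊆Class-i (inj₂ (x≢0 , x∈rot-v′)) = x≢0 , trans (pointWeight-sameLine x≢0 x∈rot-v′)
        (trans (cong pointWeight (perp-rot v′)) (pointWeight-unique weight-v′))

    PointWeight-from-codeword : ∀ {v′ W p} → v′ ≢ 0v → W + p ≡ n →
      RankWeight (Klincomb (rot v′) G) W → PointWeight U v′ p
    PointWeight-from-codeword {v′} v′≢0 e rw = subst (λ w → PointWeight U w _) (perp-rot v′)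
      (subst (PointWeight U _) (codeword-pointWeight (rot-nonzero v′≢0) e rw) (pointWeight-spec _))

    off-perp-x₀⇒weight≤1 : ∀ v′ → v′ ≢ 0v → ¬ OnPoint (perp x₀) v′ →
      PointWeight U v′ 0 ⊎ PointWeight U v′ 1
    off-perp-x₀⇒weight≤1 v′ v′≢0 off
      with three-weights (Klincomb (rot v′) G) (rot v′ , refl) (rot-nonzero v′≢0 ∘ rank2 (rot v′))
    ... | inj₁ rw        =
      ⊥-elim (off (weight-i⇒on-perp-x₀ v′ v′≢0 (PointWeight-from-codeword v′≢0 weight-split rw)))
    ... | inj₂ (inj₁ rw) = inj₂ (PointWeight-from-codeword v′≢0 (ℕ.m∸n+n≡m (ℕ.≤-trans (s≤s z≤n) 2≤n)) rw)
    ... | inj₂ (inj₂ rw) = inj₁ (PointWeight-from-codeword v′≢0 (ℕ.+-identityʳ n) rw)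

    distribution⇒club : IsClub U i
    distribution⇒club = perp x₀ , perp-nonzero x₀≢0 ,
      subst (PointWeight U (perp x₀)) weight-x₀ (pointWeight-spec (perp x₀)) ,
      off-perp-x₀⇒weight≤1 , weight-i⇒on-perp-x₀

open import Data.Nat using (_*_; _^_; _∸_)

proposition8p3 : (F K : FiniteField) (E : Extension F K) (q n i : ℕ) →
    card F ≡ q → card K ≡ q ^ n → 1 ≤ i →
    let open LinAlg E in
    -- (1) L_U an i-club  ⇒  weight distribution of every associated code
    ((G : Gen n) →
      HasFDim (System G) n → KSpansAll (System G) → IsClub (System G) i →
        CountIs (λ c → InCode G c × RankWeight c (n ∸ i)) (q ^ n ∸ 1)
        × CountIs (λ c → InCode G c × RankWeight c (n ∸ 1))
                  ((q ^ n ∸ 1) * geomSum q i n)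
        × CountIs (λ c → InCode G c × RankWeight c n)
                  ((q ^ n ∸ 1) * (q ^ n ∸ geomSum q i n)))
    ×
    -- (2) converse
    ((G : Gen n) →
      KRank2 G → NonDegenerate G →
      (∀ c w → InCode G c → ¬ (c ≡ 0v) → RankWeight c w → n ∸ i ≤ w) →
      CountIs (λ c → InCode G c × RankWeight c (n ∸ i)) (q ^ n ∸ 1) →
      (∀ c → InCode G c → ¬ (c ≡ 0v) →
        RankWeight c (n ∸ i) ⊎ RankWeight c (n ∸ 1) ⊎ RankWeight c n) →
      IsClub (System G) i)
proposition8p3 F K E q n i refl card-K 1≤i =
  (λ G dim-U spans club → ClubToDistribution.club⇒weightDistribution E card-K 1≤i G dim-U spans club) ,
  (λ G rank2 nondegenerate _ count-n∸i three-weights →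
    DistributionToClub.distribution⇒club E card-K G rank2 nondegenerate count-n∸i three-weights)
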